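{- Let $n\ge 1$. For every integer $k\ge 0$, \[ \sum_{\substack{\sigma\in\mathcal{I}_n(321)\\ \mathrm{des}(\sigma)=k}} q^{\mathrm{maj}(\sigma)} = q^{k^2}{\lceil n/2\rceil \brack k}_q{\lfloor n/2\rfloor \brack k}_q , \] and for every integer $\ell$ with $1\le \ell\le \lfloor n/2\rfloor+1$, \[ \sum_{\substack{\sigma\in\mathcal{I}_n(321)\\ \mathrm{lead}(\sigma)=\ell}} q^{\mathrm{maj}(\sigma)} = \sum_{k\ge 0} q^{k^2+k\ell+\ell-1}{\lceil n/2\rceil-1 \brack k}_q{\lfloor n/2\rfloor-\ell+1 \brack k}_q . \]
   Context: $\mathfrak{S}_n$ is the set of permutations $\sigma=\sigma_1\cdots\sigma_n$ of $\{1,\dots,n\}$ in one-line notation. $\sigma$ is 321-avoiding if it has no decreasing subsequence of length three. $\mathcal{I}_n(321)$ denotes the set of involutions ($\sigma^{ -1}=\sigma$) in $\mathfrak{S}_n$ that are 321-avoiding. The descent set is $\mathrm{Des}(\sigma)=\{i: 1\le i\le n-1,\ \sigma_i>\sigma_{i+1}\}$, $\mathrm{des}(\sigma)=|\mathrm{Des}(\sigma)|$, $\mathrm{maj}(\sigma)=\sum_{i\in\mathrm{Des}(\sigma)} i$, and $\mathrm{lead}(\sigma)=\sigma_1$. The $q$-binomial coefficient is ${m\brack k}_q=\frac{[m]!_q}{[k]!_q[m-k]!_q}$ for $0\le k\le m$ with $[m]!_q=[1]_q\cdots[m]_q$, $[i]_q=1+q+\cdots+q^{i-1}$, and ${m\brack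 k}_q=0$ if $k>m$. -}

module Defs where

import Data.Nat
open import Data.Nat using (ℕ; zero; suc; _+_; _*_; _∸_; _^_; _≤_; _<_; _<ᵇ_; _≤?_; NonZero; ⌈_/2⌉; ⌊_/2⌋)
open import Data.Nat.Properties using (m*n≢0)
open import Data.Nat.DivMod using (_/_)
open import Data.Bool using (Bool; true; false; if_then_else_)
import Data.Fin
open import Data.Fin using (Fin; toℕ; _<?_) renaming (_<_ to _<ᶠ_)
open import Data.Fin.Properties using (all?; _≟_)
open import Data.Vec using (Vec; []; _∷_; lookup; toList)
open import Data.List using (List; []; _∷_; [_]; map; concatMap; filter; length; upTo)
open import Data.Nat.ListAction using (sum)
open import Data.Product using (_×_)
open import Relation.Nullary using (¬_; Dec; yes; no)
open import Relation.Nullary.Decidable using (_×-dec_; ¬?)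
open import Relation.Unary using (Decidable)
open import Relation.Binary.PropositionalEquality using (_≡_)

-- Permutations of {1,…,n} are represented 0-indexed as vectors
-- σ : Vec (Fin n) n (one-line notation, σ_{i+1} = lookup σ i, values
-- shifted down by one; comparisons are unaffected by the shift).

allWords : {A : Set} → List A → (m : ℕ) → List (Vec A m)
allWords xs zero    = [ [] ]
allWords xs (suc m) = concatMap (λ x → map (x ∷_) (allWords xs m)) xs

allFinList : (n : ℕ) → List (Fin n)
allFinList zero    = []
allFinList (suc n) = Data.Fin.zero ∷ map Data.Fin.suc (allFinList n)

allMaps : (n : ℕ) → List (Vec (Fin n) n)
allMaps n = allWords (allFinList n) n

-- σ is an involution: σ ∘ σ = id (this forces σ to be a permutation)
IsInvolution : {n : ℕ} → Vec (Fin n) n → Set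
IsInvolution σ = ∀ i → lookup σ (lookup σ i) ≡ i

Avoids321 : {n : ℕ} → Vec (Fin n) n → Set
Avoids321 σ = ∀ i j k → i <ᶠ j → j <ᶠ k →
  ¬ (lookup σ k <ᶠ lookup σ j × lookup σ j <ᶠ lookup σ i)

IsInvolution? : {n : ℕ} → Decidable (IsInvolution {n})
IsInvolution? σ = all? (λ i → lookup σ (lookup σ i) ≟ i)

Avoids321? : {n : ℕ} → Decidable (Avoids321 {n})
Avoids321? σ = all? λ i → all? λ j → all? λ k →
  dec→ (i <? j) (dec→ (j <? k) (¬? ((lookup σ k <? lookup σ j) ×-dec (lookup σ j <? lookup σ i))))
  where
  dec→ : {P Q : Set} → Dec P → Dec Q → Dec (P → Q)
  dec→ _       (yes q) = yes (λ _ → q)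
  dec→ (yes p) (no ¬q) = no (λ f → ¬q (f p))
  dec→ (no ¬p) (no _)  = yes (λ p → Data.Empty.⊥-elim (¬p p))
    where import Data.Empty

I321 : (n : ℕ) → List (Vec (Fin n) n)
I321 n = filter (λ σ → IsInvolution? σ ×-dec Avoids321? σ) (allMaps n)

-- statistics (positions are 1-indexed as in the paper)

descents : ℕ → List ℕ → List ℕ
descents i []           = []
descents i (a ∷ [])     = []
descents i (a ∷ b ∷ w)  =
  if b <ᵇ a then i ∷ descents (suc i) (b ∷ w) else descents (suc i) (b ∷ w)

word : {n : ℕ} → Vec (Fin n) n → List ℕ
word σ = map toℕ (toList σ)

Des : {n : ℕ} → Vec (Fin n) n → List ℕ
Des σ = descents 1 (word σ)

des : {n : ℕ} → Vec (Fin n) n → ℕ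
des σ = length (Des σ)

maj : {n : ℕ} → Vec (Fin n) n → ℕ
maj σ = sum (Des σ)

-- lead(σ) = σ₁ (as a value in {1,…,n}); only used for n ≥ 1
lead : {n : ℕ} → Vec (Fin n) n → ℕ
lead σ with word σ
... | []    = 0
... | x ∷ _ = suc x

qint : ℕ → ℕ → ℕ
qint q zero    = 0
qint q (suc i) = suc (q * qint q i)

qfact : ℕ → ℕ → ℕ
qfact q zero    = 1
qfact q (suc m) = qint q (suc m) * qfact q m

qfact-nonZero : ∀ q m → NonZero (qfact q m)
qfact-nonZero q zero    = _
qfact-nonZero q (suc m) = m*n≢0 (qint q (suc m)) (qfact q m) {{_}} {{qfact-nonZero q m}}

qbinom : ℕ → ℕ → ℕ → ℕ
qbinom q m k with k ≤? m
... | yes _ = (qfact q m / (qfact q k * qfact q (m ∸ k)))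
                {{m*n≢0 _ _ {{qfact-nonZero q k}} {{qfact-nonZero q (m ∸ k)}}}}
... | no _  = 0

majGF-des : ℕ → (n k : ℕ) → ℕ
majGF-des q n k =
  sum (map (λ σ → q ^ maj σ) (filter (λ σ → des σ Data.Nat.≟ k) (I321 n)))

majGF-lead : ℕ → (n ℓ : ℕ) → ℕ
majGF-lead q n ℓ =
  sum (map (λ σ → q ^ maj σ) (filter (λ σ → lead σ Data.Nat.≟ ℓ) (I321 n)))

-- right-hand side of the second identity; the sum over k ≥ 0 is truncated
-- at k ≤ n, since all terms with k ≥ ⌈n/2⌉ vanish (q-binomial with k > m).
leadRHS : ℕ → (n ℓ : ℕ) → ℕ
leadRHS q n ℓ = sum (map (λ k →
    q ^ (k * k + k * ℓ + ℓ ∸ 1)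
    * qbinom q (⌈ n /2⌉ ∸ 1) k
    * qbinom q (⌊ n /2⌋ + 1 ∸ ℓ) k)
  (upTo (suc n)))

-- A 321-avoiding involution σ is encoded by the path whose i-th step goes up, down or stays
-- flat according as σ i > i, σ i < i or σ i = i. Its arcs never nest, so this is a bijection
-- onto the paths from height 0 to 0 with flat steps only at height 0, inverted by matching the
-- r-th up step with the r-th down step. A descent of σ is exactly a peak UD of its path at the
-- same position, so maj becomes the sum of the peak positions, and σ 1 - 1 is the length of the
-- initial run of up steps. Splitting paths by their first steps gives a recurrence in the length
-- that q^(k²) [a k]_q [b k]_q also satisfies by q-Pascal. This evaluates the peak generating
-- function of the paths from any height, which gives the first formula directly and the second
-- after stripping the initial U^(ℓ-1) D.

module Submission where

open import Defs
open import Data.Bool using (Bool; true; false; T; if_then_else_)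
open import Data.Empty using (⊥; ⊥-elim)
open import Data.Fin using (Fin; toℕ; fromℕ<)
open import Data.Fin.Properties using (toℕ-injective; toℕ<n; toℕ-fromℕ<)
import Data.Fin.Properties as Finₚ
open import Data.List using (List; []; _∷_; [_]; map; _++_; length; drop; filter; upTo; applyUpTo)
open import Data.List.Properties using (map-++; map-∘; map-cong; map-cong-local; map-id; length-map; length-applyUpTo)
import Data.List.Properties as Listₚ
open import Data.List.Membership.Propositional using (_∈_)
open import Data.List.Membership.Propositional.Properties using (∈-map⁺; ∈-map⁻; ∈-++⁺ˡ; ∈-++⁺ʳ; ∈-++⁻; ∈-filter⁺; ∈-filter⁻; ∈-concatMap⁺)
open import Data.List.Membership.Propositional.Properties.WithK using (unique∧set⇒bag)
open import Data.List.Relation.Binary.BagAndSetEquality using (∼bag⇒↭)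
open import Data.List.Relation.Binary.Disjoint.Propositional using (Disjoint)
import Data.List.Relation.Binary.Permutation.Propositional.Properties as Permₚ
import Data.List.Relation.Unary.All as All
import Data.List.Relation.Unary.All.Properties as Allₚ
open import Data.List.Relation.Unary.AllPairs using ([]; _∷_)
import Data.List.Relation.Unary.AllPairs as AllPairs
import Data.List.Relation.Unary.AllPairs.Properties as AllPairsₚ
open import Data.List.Relation.Unary.Any using (here; there)
import Data.List.Relation.Unary.Any as Any
open import Data.List.Relation.Unary.Unique.Propositional using (Unique)
import Data.List.Relation.Unary.Unique.Propositional.Properties as Uniqueₚ
open import Data.Nat
open import Data.Nat.DivMod using (m*n/n≡m)
open import Data.Nat.Induction using (<-rec)
open import Data.Nat.ListAction using (sum)
open import Data.Nat.ListAction.Properties using (sum-++; sum-↭)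
open import Data.Nat.Properties
open import Data.Nat.Tactic.RingSolver using (solve-∀)
open import Data.Product using (_×_; _,_; proj₁; proj₂; Σ)
open import Data.Sum using (inj₁; inj₂)
open import Data.Unit using (tt)
open import Data.Vec using (Vec; lookup; tabulate; toList)
open import Data.Vec.Properties using (lookup∘tabulate)
import Data.Vec.Properties as Vecₚ
open import Function using (_∘_)
open import Function.Bundles using (mk⇔)
open import Relation.Binary using (Tri; tri<; tri≈; tri>)
open import Relation.Binary.PropositionalEquality hiding ([_])
open import Relation.Nullary using (¬_; yes; no; does; _×-dec_)
open import Relation.Unary using (Decidable)

sumOf : {A : Set} → (A → ℕ) → List A → ℕ
sumOf f xs = sum (map f xs)

sumOf-++ : {A : Set} (f : A → ℕ) (xs ys : List A) → sumOf f (xs ++ ys) ≡ sumOf f xs + sumOf f ys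
sumOf-++ f xs ys = trans (cong sum (map-++ f xs ys)) (sum-++ (map f xs) (map f ys))

sumOf-map : {A B : Set} (f : B → ℕ) (g : A → B) (xs : List A) → sumOf f (map g xs) ≡ sumOf (f ∘ g) xs
sumOf-map f g xs = cong sum (sym (map-∘ xs))

sumOf-cong : {A : Set} {f g : A → ℕ} → (∀ x → f x ≡ g x) → (xs : List A) → sumOf f xs ≡ sumOf g xs
sumOf-cong f≗g xs = cong sum (map-cong f≗g xs)

sumOf-cong∈ : {A : Set} {f g : A → ℕ} (xs : List A) → (∀ x → x ∈ xs → f x ≡ g x) → sumOf f xs ≡ sumOf g xs
sumOf-cong∈ xs f≗g = cong sum (map-cong-local (All.tabulate λ {x} x∈xs → f≗g x x∈xs))

sumOf-*ˡ : {A : Set} (c : ℕ) (f : A → ℕ) (xs : List A) → sumOf (λ x → c * f x) xs ≡ c * sumOf f xs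
sumOf-*ˡ c f []       = sym (*-zeroʳ c)
sumOf-*ˡ c f (x ∷ xs) rewrite sumOf-*ˡ c f xs = sym (*-distribˡ-+ c (f x) _)

sumOf-zero : {A : Set} (xs : List A) → sumOf (λ _ → 0) xs ≡ 0
sumOf-zero []       = refl
sumOf-zero (_ ∷ xs) = sumOf-zero xs

sumOf-+ : {A : Set} (f g : A → ℕ) (xs : List A) → sumOf (λ x → f x + g x) xs ≡ sumOf f xs + sumOf g xs
sumOf-+ f g []       = refl
sumOf-+ f g (x ∷ xs) rewrite sumOf-+ f g xs = interchange (f x) (g x) (sumOf f xs) (sumOf g xs)
  where
  interchange : ∀ a b c d → a + b + (c + d) ≡ a + c + (b + d)
  interchange = solve-∀

sumOf-swap : {A B : Set} (f : A → B → ℕ) (xs : List A) (ys : List B) →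
  sumOf (λ y → sumOf (λ x → f x y) xs) ys ≡ sumOf (λ x → sumOf (f x) ys) xs
sumOf-swap f xs []       = sym (sumOf-zero xs)
sumOf-swap f xs (y ∷ ys) rewrite sumOf-swap f xs ys = sym (sumOf-+ (λ x → f x y) (λ x → sumOf (f x) ys) xs)

sumOf-applyUpTo : (g f : ℕ → ℕ) (N : ℕ) → sumOf g (applyUpTo f N) ≡ sumOf (g ∘ f) (upTo N)
sumOf-applyUpTo g f zero    = refl
sumOf-applyUpTo g f (suc N) =
  cong (g (f 0) +_) (trans (sumOf-applyUpTo g (f ∘ suc) N) (sym (sumOf-applyUpTo (g ∘ f) suc N)))

sumOf-upTo-≡ᵇ : ∀ (x : ℕ → ℕ) {L N} → L < N → sumOf (λ k → if L ≡ᵇ k then x k else 0) (upTo N) ≡ x L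
sumOf-upTo-≡ᵇ x {zero}  {suc N} _ =
  trans (cong (x 0 +_) (trans (sumOf-applyUpTo (λ k → if 0 ≡ᵇ k then x k else 0) suc N) (sumOf-zero (upTo N))))
        (+-identityʳ (x 0))
sumOf-upTo-≡ᵇ x {suc L} {suc N} (s≤s L<N) =
  trans (sumOf-applyUpTo (λ k → if suc L ≡ᵇ k then x k else 0) suc N) (sumOf-upTo-≡ᵇ (x ∘ suc) L<N)

sum-map-suc : ∀ ns → sum (map suc ns) ≡ length ns + sum ns
sum-map-suc []       = refl
sum-map-suc (n ∷ ns) rewrite sum-map-suc ns = cong suc (+-left-comm n (length ns) (sum ns))
  where
  +-left-comm : ∀ a b c → a + (b + c) ≡ b + (a + c)
  +-left-comm = solve-∀

sum-map-+ : ∀ c ns → sum (map (c +_) ns) ≡ c * length ns + sum ns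
sum-map-+ c []       = sym (trans (+-identityʳ (c * 0)) (*-zeroʳ c))
sum-map-+ c (n ∷ ns) rewrite sum-map-+ c ns = regroup c n (length ns) (sum ns)
  where
  regroup : ∀ c n l s → c + n + (c * l + s) ≡ c * suc l + (n + s)
  regroup = solve-∀

sum-map-filter : {A : Set} {P : A → Set} (P? : Decidable P) (f : A → ℕ) (xs : List A) →
  sum (map f (filter P? xs)) ≡ sumOf (λ x → if does (P? x) then f x else 0) xs
sum-map-filter P? f []       = refl
sum-map-filter P? f (x ∷ xs) with does (P? x)
... | true  = cong (f x +_) (sum-map-filter P? f xs)
... | false = sum-map-filter P? f xs

Unique-map⁺-on : {A B : Set} (f : A → B) {xs : List A} →
  (∀ {x y} → x ∈ xs → y ∈ xs → f x ≡ f y → x ≡ y) → Unique xs → Unique (map f xs)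
Unique-map⁺-on f           _   []           = []
Unique-map⁺-on f {x ∷ xs} inj (x∉xs ∷ uxs) =
  Allₚ.map⁺ (All.tabulate λ y∈xs fx≡fy → All.lookup x∉xs y∈xs (inj (here refl) (there y∈xs) fx≡fy))
  ∷ Unique-map⁺-on f (λ x∈ y∈ → inj (there x∈) (there y∈)) uxs

map-disjoint : {A B : Set} {f g : A → B} → (∀ {a b} → f a ≢ g b) → (xs ys : List A) → Disjoint (map f xs) (map g ys)
map-disjoint fa≢gb xs ys (v∈f , v∈g) with ∈-map⁻ _ v∈f | ∈-map⁻ _ v∈g
... | _ , _ , refl | _ , _ , fa≡gb = fa≢gb fa≡gb

sumOf-∼set : {A : Set} (f : A → ℕ) {xs ys : List A} → Unique xs → Unique ys →
  (∀ {z} → z ∈ xs → z ∈ ys) → (∀ {z} → z ∈ ys → z ∈ xs) → sumOf f xs ≡ sumOf f ys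
sumOf-∼set f ux uy to from = sum-↭ (Permₚ.map⁺ f (∼bag⇒↭ (unique∧set⇒bag ux uy (mk⇔ to from))))

-- q-binomial coefficients

qbin : ℕ → ℕ → ℕ → ℕ
qbin q m       zero    = 1
qbin q zero    (suc k) = 0
qbin q (suc m) (suc k) = qbin q m k + q ^ suc k * qbin q m (suc k)

qbin≡0 : ∀ q {m k} → m < k → qbin q m k ≡ 0
qbin≡0 q {zero}  {suc k} _ = refl
qbin≡0 q {suc m} {suc k} (s≤s m<k)
  rewrite qbin≡0 q m<k | qbin≡0 q (m≤n⇒m≤1+n m<k) = *-zeroʳ (q ^ suc k)

qint-+ : ∀ q a b → qint q (a + b) ≡ qint q a + q ^ a * qint q b
qint-+ q zero    b = sym (+-identityʳ (qint q b))
qint-+ q (suc a) b rewrite qint-+ q a b = cong suc (distrib q (qint q a) (q ^ a) (qint q b))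
  where
  distrib : ∀ q x y z → q * (x + y * z) ≡ q * x + q * y * z
  distrib = solve-∀

qbin*qfact*qfact≡qfact : ∀ q {m k} → k ≤ m → qbin q m k * (qfact q k * qfact q (m ∸ k)) ≡ qfact q m
qbin*qfact*qfact≡qfact q {m} {zero} _ = trans (+-identityʳ _) (*-identityˡ (qfact q m))
qbin*qfact*qfact≡qfact q {suc m} {suc k} (s≤s k≤m) with m≤n⇒m<n∨m≡n k≤m
... | inj₂ refl rewrite qbin≡0 q (n<1+n k) | n∸n≡0 k =
  trans (regroup (qbin q k k) (q ^ suc k) (qint q (suc k)) (qfact q k))
        (cong (qint q (suc k) *_) (subst (λ z → qbin q k k * (qfact q k * qfact q z) ≡ qfact q k)
                                         (n∸n≡0 k) (qbin*qfact*qfact≡qfact q {k} ≤-refl)))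
  where
  regroup : ∀ a b c d → (a + b * 0) * (c * d * 1) ≡ c * (a * (d * 1))
  regroup = solve-∀
... | inj₁ k<m = begin
    (A + Q * B) * (I * F * qfact q (m ∸ k))
      ≡⟨ cong (λ z → (A + Q * B) * (I * F * z)) fact-m∸k ⟩
    (A + Q * B) * (I * F * (R * G))
      ≡⟨ expand A Q B I F R G ⟩
    I * (A * (F * (R * G))) + Q * R * (B * (I * F * G))
      ≡⟨ cong₂ (λ x y → I * (A * (F * x)) + Q * R * y) (sym fact-m∸k) (qbin*qfact*qfact≡qfact q k<m) ⟩
    I * (A * (F * qfact q (m ∸ k))) + Q * R * qfact q m
      ≡⟨ cong (λ x → I * x + Q * R * qfact q m) (qbin*qfact*qfact≡qfact q k≤m) ⟩
    I * qfact q m + Q * R * qfact q m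
      ≡⟨ factor I Q R (qfact q m) ⟩
    (I + Q * R) * qfact q m
      ≡⟨ cong (_* qfact q m) (sym (qint-+ q (suc k) (m ∸ k))) ⟩
    qint q (suc k + (m ∸ k)) * qfact q m
      ≡⟨ cong (λ x → qint q (suc x) * qfact q m) (m+[n∸m]≡n k≤m) ⟩
    qint q (suc m) * qfact q m ∎
  where
  open ≡-Reasoning
  A B Q I F R G : ℕ
  A = qbin q m k
  B = qbin q m (suc k)
  Q = q ^ suc k
  I = qint q (suc k)
  F = qfact q k
  R = qint q (m ∸ k)
  G = qfact q (m ∸ suc k)
  fact-m∸k : qfact q (m ∸ k) ≡ R * G
  fact-m∸k rewrite +-∸-assoc 1 k<m = refl
  expand : ∀ a b c d e f g → (a + b * c) * (d * e * (f * g)) ≡ d * (a * (e * (f * g))) + b * f * (c * (d * e * g))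
  expand = solve-∀
  factor : ∀ a b c d → a * d + b * c * d ≡ (a + b * c) * d
  factor = solve-∀

qbinom≡qbin : ∀ q m k → qbinom q m k ≡ qbin q m k
qbinom≡qbin q m k with k ≤? m
... | yes k≤m = trans (cong (λ x → (x / (qfact q k * qfact q (m ∸ k))) {{denom≢0}})
                            (sym (qbin*qfact*qfact≡qfact q k≤m)))
                      (m*n/n≡m (qbin q m k) (qfact q k * qfact q (m ∸ k)) {{denom≢0}})
  where
  denom≢0 : NonZero (qfact q k * qfact q (m ∸ k))
  denom≢0 = m*n≢0 _ _ {{qfact-nonZero q k}} {{qfact-nonZero q (m ∸ k)}}
... | no k≰m = sym (qbin≡0 q (≰⇒> k≰m))

qbinProd : ℕ → ℕ → ℕ → ℕ → ℕ
qbinProd q a b k = q ^ (k * k) * qbin q a k * qbin q b k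

qbinProd-comm : ∀ q a b k → qbinProd q a b k ≡ qbinProd q b a k
qbinProd-comm q a b k = swap (q ^ (k * k)) (qbin q a k) (qbin q b k)
  where
  swap : ∀ x y z → x * y * z ≡ x * z * y
  swap = solve-∀

δ₀ : ℕ → ℕ
δ₀ zero    = 1
δ₀ (suc _) = 0

^*δ₀ : ∀ q k → q ^ k * δ₀ k ≡ δ₀ k
^*δ₀ q zero    = refl
^*δ₀ q (suc k) = *-zeroʳ (q ^ suc k)

qbinProd-0 : ∀ q a k → qbinProd q a 0 k ≡ δ₀ k
qbinProd-0 q a zero    = refl
qbinProd-0 q a (suc k) = *-zeroʳ (q ^ (suc k * suc k) * qbin q a (suc k))

qbinProd-scaled : ∀ q a b c s k →
  q ^ s * (q ^ (c * k) * qbinProd q a b k) ≡ q ^ (k * k + k * c + s) * qbin q a k * qbin q b k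
qbinProd-scaled q a b c s k = begin
  q ^ s * (q ^ (c * k) * qbinProd q a b k)
    ≡⟨ regroup (q ^ s) (q ^ (c * k)) (q ^ (k * k)) (qbin q a k) (qbin q b k) ⟩
  q ^ (k * k) * q ^ (c * k) * q ^ s * qbin q a k * qbin q b k
    ≡⟨ cong (λ x → x * q ^ s * qbin q a k * qbin q b k)
            (trans (sym (^-distribˡ-+-* q (k * k) (c * k))) (cong (λ z → q ^ (k * k + z)) (*-comm c k))) ⟩
  q ^ (k * k + k * c) * q ^ s * qbin q a k * qbin q b k
    ≡⟨ cong (λ x → x * qbin q a k * qbin q b k) (sym (^-distribˡ-+-* q (k * k + k * c) s)) ⟩
  q ^ (k * k + k * c + s) * qbin q a k * qbin q b k ∎
  where
  open ≡-Reasoning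
  regroup : ∀ S C K A B → S * (C * (K * A * B)) ≡ K * C * S * A * B
  regroup = solve-∀

^-square-suc : ∀ q j → q ^ (suc j * suc j) ≡ q ^ (j * j) * q ^ j * q ^ suc j
^-square-suc q j = begin
  q ^ (suc j * suc j)         ≡⟨ cong (q ^_) (square-suc j) ⟩
  q ^ (j * j + j + suc j)     ≡⟨ ^-distribˡ-+-* q (j * j + j) (suc j) ⟩
  q ^ (j * j + j) * q ^ suc j ≡⟨ cong (_* q ^ suc j) (^-distribˡ-+-* q (j * j) j) ⟩
  q ^ (j * j) * q ^ j * q ^ suc j ∎
  where
  open ≡-Reasoning
  square-suc : ∀ j → suc j * suc j ≡ j * j + j + suc j
  square-suc = solve-∀

-- The weight of the paths that begin with a peak UD: that peak sits at position 1
-- and shifts the remaining k - 1 peaks by 2, giving the factor q ^ (2k - 1).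
withFirstPeak : ℕ → (ℕ → ℕ) → ℕ → ℕ
withFirstPeak q f zero    = 0
withFirstPeak q f (suc j) = q ^ suc j * (q ^ j * f j)

withFirstPeak-cong : ∀ q {f g} → (∀ j → f j ≡ g j) → ∀ k → withFirstPeak q f k ≡ withFirstPeak q g k
withFirstPeak-cong q f≗g zero    = refl
withFirstPeak-cong q f≗g (suc j) = cong (λ z → q ^ suc j * (q ^ j * z)) (f≗g j)

qbinProd-rec : ∀ q a b k →
  qbinProd q (suc a) (suc b) k + q ^ k * (q ^ k * qbinProd q a b k)
    ≡ q ^ k * qbinProd q (suc a) b k + withFirstPeak q (qbinProd q a b) k + q ^ k * qbinProd q a (suc b) k
qbinProd-rec q a b zero    = refl
qbinProd-rec q a b (suc j) rewrite ^-square-suc q j =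
  pascal (q ^ (j * j)) (q ^ j) q (qbin q a (suc j)) (qbin q a j) (qbin q b (suc j)) (qbin q b j)
  where
  pascal : ∀ P R q A A' B B' →
    P * R * (q * R) * (A' + q * R * A) * (B' + q * R * B) + q * R * (q * R * (P * R * (q * R) * A * B))
      ≡ q * R * (P * R * (q * R) * (A' + q * R * A) * B) + q * R * (R * (P * A' * B'))
        + q * R * (P * R * (q * R) * A * (B' + q * R * B))
  pascal = solve-∀

-- Paths and their peaks

data Step : Set where
  U D F : Step

-- Paths from height h down to height 0 that never go below 0 and take flat steps only
-- at height 0.
paths : ℕ → ℕ → List (List Step)
paths zero    zero    = [ [] ]
paths (suc h) zero    = []
paths zero    (suc m) = map (U ∷_) (paths 1 m) ++ map (F ∷_) (paths 0 m)
paths (suc h) (suc m) = map (U ∷_) (paths (suc (suc h)) m) ++ map (D ∷_) (paths h m)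

IsPath : ℕ → List Step → Set
IsPath h       []      = h ≡ 0
IsPath h       (U ∷ w) = IsPath (suc h) w
IsPath zero    (D ∷ w) = ⊥
IsPath (suc h) (D ∷ w) = IsPath h w
IsPath h       (F ∷ w) = h ≡ 0 × IsPath 0 w

IsPath⇒∈paths : ∀ h w → IsPath h w → w ∈ paths h (length w)
IsPath⇒∈paths .zero   []      refl       = here refl
IsPath⇒∈paths zero    (U ∷ w) p          = ∈-++⁺ˡ (∈-map⁺ (U ∷_) (IsPath⇒∈paths 1 w p))
IsPath⇒∈paths (suc h) (U ∷ w) p          = ∈-++⁺ˡ (∈-map⁺ (U ∷_) (IsPath⇒∈paths (suc (suc h)) w p))
IsPath⇒∈paths (suc h) (D ∷ w) p          = ∈-++⁺ʳ (map (U ∷_) (paths (suc (suc h)) (length w)))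
                                                   (∈-map⁺ (D ∷_) (IsPath⇒∈paths h w p))
IsPath⇒∈paths .zero   (F ∷ w) (refl , p) = ∈-++⁺ʳ (map (U ∷_) (paths 1 (length w)))
                                                   (∈-map⁺ (F ∷_) (IsPath⇒∈paths 0 w p))

∈paths⇒IsPath : ∀ h m {w} → w ∈ paths h m → IsPath h w × length w ≡ m
∈paths⇒IsPath zero    zero    (here refl) = refl , refl
∈paths⇒IsPath zero    (suc m) w∈ with ∈-++⁻ (map (U ∷_) (paths 1 m)) w∈
... | inj₁ w∈U with ∈-map⁻ (U ∷_) w∈U
...   | r , r∈ , refl = let (p , len) = ∈paths⇒IsPath 1 m r∈ in p , cong suc len
∈paths⇒IsPath zero    (suc m) w∈ | inj₂ w∈F with ∈-map⁻ (F ∷_) w∈F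
...   | r , r∈ , refl = let (p , len) = ∈paths⇒IsPath 0 m r∈ in (refl , p) , cong suc len
∈paths⇒IsPath (suc h) (suc m) w∈ with ∈-++⁻ (map (U ∷_) (paths (suc (suc h)) m)) w∈
... | inj₁ w∈U with ∈-map⁻ (U ∷_) w∈U
...   | r , r∈ , refl = let (p , len) = ∈paths⇒IsPath (suc (suc h)) m r∈ in p , cong suc len
∈paths⇒IsPath (suc h) (suc m) w∈ | inj₂ w∈D with ∈-map⁻ (D ∷_) w∈D
...   | r , r∈ , refl = let (p , len) = ∈paths⇒IsPath h m r∈ in p , cong suc len

paths-empty : ∀ {m h} → m < h → paths h m ≡ []
paths-empty {zero}  {suc h} _ = refl
paths-empty {suc m} {suc h} (s≤s m<h)
  rewrite paths-empty {m} {suc (suc h)} (m<n⇒m<1+n (m<n⇒m<1+n m<h)) | paths-empty m<h = refl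

Unique-paths : ∀ h m → Unique (paths h m)
Unique-paths zero    zero    = All.[] ∷ []
Unique-paths (suc h) zero    = []
Unique-paths zero    (suc m) = Uniqueₚ.++⁺ (Uniqueₚ.map⁺ Listₚ.∷-injectiveʳ (Unique-paths 1 m))
                                           (Uniqueₚ.map⁺ Listₚ.∷-injectiveʳ (Unique-paths 0 m))
                                           (map-disjoint (λ ()) (paths 1 m) (paths 0 m))
Unique-paths (suc h) (suc m) = Uniqueₚ.++⁺ (Uniqueₚ.map⁺ Listₚ.∷-injectiveʳ (Unique-paths (suc (suc h)) m))
                                           (Uniqueₚ.map⁺ Listₚ.∷-injectiveʳ (Unique-paths h m))
                                           (map-disjoint (λ ()) (paths (suc (suc h)) m) (paths h m))

isPeak : Step → Step → Bool
isPeak U D = true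
isPeak _ _ = false

peaks : ℕ → List Step → List ℕ
peaks i []          = []
peaks i (a ∷ [])    = []
peaks i (a ∷ b ∷ w) = if isPeak a b then i ∷ peaks (suc i) (b ∷ w) else peaks (suc i) (b ∷ w)

peaks-suc : ∀ i w → peaks (suc i) w ≡ map suc (peaks i w)
peaks-suc i []          = refl
peaks-suc i (a ∷ [])    = refl
peaks-suc i (a ∷ b ∷ w) = step (isPeak a b) (peaks-suc (suc i) (b ∷ w))
  where
  step : ∀ {P Q} c → P ≡ map suc Q → (if c then suc i ∷ P else P) ≡ map suc (if c then i ∷ Q else Q)
  step true  P≡Q = cong (suc i ∷_) P≡Q
  step false P≡Q = P≡Q

peaks-+ : ∀ c i w → peaks (c + i) w ≡ map (c +_) (peaks i w)
peaks-+ zero    i w = sym (map-id (peaks i w))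
peaks-+ (suc c) i w = trans (peaks-suc (c + i) w) (trans (cong (map suc) (peaks-+ c i w)) (sym (map-∘ (peaks i w))))

peaks-D : ∀ i w → peaks i (D ∷ w) ≡ peaks (suc i) w
peaks-D i []      = refl
peaks-D i (_ ∷ _) = refl

peaks-F : ∀ i w → peaks i (F ∷ w) ≡ peaks (suc i) w
peaks-F i []      = refl
peaks-F i (_ ∷ _) = refl

length-peaks : ∀ i w → length (peaks i w) ≤ length w
length-peaks i []          = z≤n
length-peaks i (a ∷ [])    = z≤n
length-peaks i (a ∷ b ∷ w) = step (isPeak a b) (length-peaks (suc i) (b ∷ w))
  where
  step : ∀ c → length (peaks (suc i) (b ∷ w)) ≤ length (b ∷ w) →
    length (if c then i ∷ peaks (suc i) (b ∷ w) else peaks (suc i) (b ∷ w)) ≤ length (a ∷ b ∷ w)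
  step true  ≤len = s≤s ≤len
  step false ≤len = m≤n⇒m≤1+n ≤len

peakWeight : ℕ → ℕ → ℕ → List Step → ℕ
peakWeight q k i w = if length (peaks i w) ≡ᵇ k then q ^ sum (peaks i w) else 0

peakWeight-suc : ∀ q k i w → peakWeight q k (suc i) w ≡ q ^ k * peakWeight q k i w
peakWeight-suc q k i w rewrite peaks-suc i w | length-map suc (peaks i w) | sum-map-suc (peaks i w)
  with length (peaks i w) ≡ᵇ k in eq
... | true  = trans (cong (λ x → q ^ (x + sum (peaks i w))) (≡ᵇ⇒≡ (length (peaks i w)) k (subst T (sym eq) _)))
                    (^-distribˡ-+-* q k _)
... | false = sym (*-zeroʳ (q ^ k))

peakWeight-D : ∀ q k i w → peakWeight q k i (D ∷ w) ≡ peakWeight q k (suc i) w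
peakWeight-D q k i w = cong (λ p → if length p ≡ᵇ k then q ^ sum p else 0) (peaks-D i w)

peakWeight-F : ∀ q k i w → peakWeight q k i (F ∷ w) ≡ peakWeight q k (suc i) w
peakWeight-F q k i w = cong (λ p → if length p ≡ᵇ k then q ^ sum p else 0) (peaks-F i w)

peakWeight-UD : ∀ q j w → peakWeight q (suc j) 1 (U ∷ D ∷ w) ≡ q * (q ^ j * (q ^ j * peakWeight q j 1 w))
peakWeight-UD q j w = begin
  peakWeight q (suc j) 1 (U ∷ D ∷ w) ≡⟨ pull-q (length (peaks 2 (D ∷ w)) ≡ᵇ j) ⟩
  q * peakWeight q j 2 (D ∷ w)       ≡⟨ cong (q *_) (peakWeight-D q j 2 w) ⟩
  q * peakWeight q j 3 w             ≡⟨ cong (q *_) (trans (peakWeight-suc q j 2 w) (cong (q ^ j *_) (peakWeight-suc q j 1 w))) ⟩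
  q * (q ^ j * (q ^ j * peakWeight q j 1 w)) ∎
  where
  open ≡-Reasoning
  pull-q : ∀ c → (if c then q ^ suc (sum (peaks 2 (D ∷ w))) else 0) ≡ q * (if c then q ^ sum (peaks 2 (D ∷ w)) else 0)
  pull-q true  = refl
  pull-q false = sym (*-zeroʳ q)

peakMaj : ℕ → ℕ → List Step → ℕ
peakMaj q i w = q ^ sum (peaks i w)

peakMaj-+ : ∀ q c i w → peakMaj q (c + i) w ≡ q ^ (c * length (peaks i w)) * peakMaj q i w
peakMaj-+ q c i w = begin
  q ^ sum (peaks (c + i) w)                        ≡⟨ cong (λ p → q ^ sum p) (peaks-+ c i w) ⟩
  q ^ sum (map (c +_) (peaks i w))                 ≡⟨ cong (q ^_) (sum-map-+ c (peaks i w)) ⟩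
  q ^ (c * length (peaks i w) + sum (peaks i w))   ≡⟨ ^-distribˡ-+-* q (c * length (peaks i w)) _ ⟩
  q ^ (c * length (peaks i w)) * peakMaj q i w     ∎
  where open ≡-Reasoning

peakMaj-by-peaks : ∀ q c w {N} → length (peaks 1 w) < N →
  peakMaj q (c + 1) w ≡ sumOf (λ k → q ^ (c * k) * peakWeight q k 1 w) (upTo N)
peakMaj-by-peaks q c w {N} #peaks<N = begin
  peakMaj q (c + 1) w                             ≡⟨ peakMaj-+ q c 1 w ⟩
  q ^ (c * length (peaks 1 w)) * peakMaj q 1 w    ≡⟨ sym (sumOf-upTo-≡ᵇ (λ k → q ^ (c * k) * peakMaj q 1 w) #peaks<N) ⟩
  sumOf (λ k → if length (peaks 1 w) ≡ᵇ k then q ^ (c * k) * peakMaj q 1 w else 0) (upTo N)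
                                                  ≡⟨ sumOf-cong select (upTo N) ⟩
  sumOf (λ k → q ^ (c * k) * peakWeight q k 1 w) (upTo N) ∎
  where
  open ≡-Reasoning
  select : ∀ k → (if length (peaks 1 w) ≡ᵇ k then q ^ (c * k) * peakMaj q 1 w else 0) ≡ q ^ (c * k) * peakWeight q k 1 w
  select k with length (peaks 1 w) ≡ᵇ k
  ... | true  = refl
  ... | false = sym (*-zeroʳ (q ^ (c * k)))

-- The generating function of paths by peaks

pathGF : ℕ → ℕ → ℕ → ℕ → ℕ
pathGF q m h k = sumOf (peakWeight q k 1) (paths h m)

pathGF-U : ℕ → ℕ → ℕ → ℕ → ℕ
pathGF-U q m h k = sumOf (peakWeight q k 1) (map (U ∷_) (paths (suc h) m))

sumOf-peakWeight-suc : ∀ q k i xs → sumOf (peakWeight q k (suc i)) xs ≡ q ^ k * sumOf (peakWeight q k i) xs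
sumOf-peakWeight-suc q k i xs = trans (sumOf-cong (peakWeight-suc q k i) xs) (sumOf-*ˡ (q ^ k) (peakWeight q k i) xs)

sumOf-peakWeight-D : ∀ q k i xs → sumOf (peakWeight q k i) (map (D ∷_) xs) ≡ q ^ k * sumOf (peakWeight q k i) xs
sumOf-peakWeight-D q k i xs =
  trans (sumOf-map (peakWeight q k i) (D ∷_) xs)
        (trans (sumOf-cong (peakWeight-D q k i) xs) (sumOf-peakWeight-suc q k i xs))

sumOf-peakWeight-F : ∀ q k i xs → sumOf (peakWeight q k i) (map (F ∷_) xs) ≡ q ^ k * sumOf (peakWeight q k i) xs
sumOf-peakWeight-F q k i xs =
  trans (sumOf-map (peakWeight q k i) (F ∷_) xs)
        (trans (sumOf-cong (peakWeight-F q k i) xs) (sumOf-peakWeight-suc q k i xs))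

pathGF-suc : ∀ q m h k → pathGF q (suc m) h k ≡ pathGF-U q m h k + q ^ k * pathGF q m (h ∸ 1) k
pathGF-suc q m zero    k = trans (sumOf-++ (peakWeight q k 1) (map (U ∷_) (paths 1 m)) _)
                                 (cong (pathGF-U q m 0 k +_) (sumOf-peakWeight-F q k 1 (paths 0 m)))
pathGF-suc q m (suc h) k = trans (sumOf-++ (peakWeight q k 1) (map (U ∷_) (paths (suc (suc h)) m)) _)
                                 (cong (pathGF-U q m (suc h) k +_) (sumOf-peakWeight-D q k 1 (paths h m)))

sumOf-peakWeight-UU : ∀ q k xs → sumOf (peakWeight q k 1) (map (U ∷_) (map (U ∷_) xs))
                                   ≡ q ^ k * sumOf (peakWeight q k 1) (map (U ∷_) xs)
sumOf-peakWeight-UU q k xs = begin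
  sumOf (peakWeight q k 1) (map (U ∷_) (map (U ∷_) xs)) ≡⟨ sumOf-map (peakWeight q k 1) (U ∷_) (map (U ∷_) xs) ⟩
  sumOf (peakWeight q k 1 ∘ (U ∷_)) (map (U ∷_) xs)    ≡⟨ sumOf-map (peakWeight q k 1 ∘ (U ∷_)) (U ∷_) xs ⟩
  sumOf (peakWeight q k 2 ∘ (U ∷_)) xs                 ≡⟨ sumOf-cong (λ w → peakWeight-suc q k 1 (U ∷ w)) xs ⟩
  sumOf (λ w → q ^ k * peakWeight q k 1 (U ∷ w)) xs    ≡⟨ sumOf-*ˡ (q ^ k) (peakWeight q k 1 ∘ (U ∷_)) xs ⟩
  q ^ k * sumOf (peakWeight q k 1 ∘ (U ∷_)) xs         ≡⟨ cong (q ^ k *_) (sym (sumOf-map (peakWeight q k 1) (U ∷_) xs)) ⟩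
  q ^ k * sumOf (peakWeight q k 1) (map (U ∷_) xs)      ∎
  where open ≡-Reasoning

sumOf-peakWeight-UD : ∀ q k xs → sumOf (peakWeight q k 1) (map (U ∷_) (map (D ∷_) xs))
                                   ≡ withFirstPeak q (λ j → sumOf (peakWeight q j 1) xs) k
sumOf-peakWeight-UD q k xs = trans (sumOf-map (peakWeight q k 1) (U ∷_) (map (D ∷_) xs))
                                   (trans (sumOf-map (peakWeight q k 1 ∘ (U ∷_)) (D ∷_) xs) (UD k))
  where
  UD : ∀ k → sumOf (λ w → peakWeight q k 1 (U ∷ D ∷ w)) xs ≡ withFirstPeak q (λ j → sumOf (peakWeight q j 1) xs) k
  UD zero    = sumOf-zero xs
  UD (suc j) = begin
    sumOf (λ w → peakWeight q (suc j) 1 (U ∷ D ∷ w)) xs        ≡⟨ sumOf-cong (peakWeight-UD q j) xs ⟩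
    sumOf (λ w → q * (q ^ j * (q ^ j * peakWeight q j 1 w))) xs ≡⟨ sumOf-*ˡ q _ xs ⟩
    q * sumOf (λ w → q ^ j * (q ^ j * peakWeight q j 1 w)) xs   ≡⟨ cong (q *_) (trans (sumOf-*ˡ (q ^ j) _ xs)
                                                                      (cong (q ^ j *_) (sumOf-*ˡ (q ^ j) _ xs))) ⟩
    q * (q ^ j * (q ^ j * sumOf (peakWeight q j 1) xs))        ≡⟨ sym (*-assoc q (q ^ j) _) ⟩
    q ^ suc j * (q ^ j * sumOf (peakWeight q j 1) xs)          ∎
    where open ≡-Reasoning

pathGF-U-suc : ∀ q m h k → pathGF-U q (suc m) h k ≡ q ^ k * pathGF-U q m (suc h) k + withFirstPeak q (pathGF q m h) k
pathGF-U-suc q m h k =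
  trans (cong (sumOf (peakWeight q k 1)) (map-++ (U ∷_) (map (U ∷_) (paths (suc (suc h)) m)) (map (D ∷_) (paths h m))))
        (trans (sumOf-++ (peakWeight q k 1) (map (U ∷_) (map (U ∷_) (paths (suc (suc h)) m))) _)
               (cong₂ _+_ (sumOf-peakWeight-UU q k (paths (suc (suc h)) m)) (sumOf-peakWeight-UD q k (paths h m))))

pathGF-rec : ∀ q m h k →
  pathGF q (suc (suc m)) h k + q ^ k * (q ^ k * pathGF q m h k)
    ≡ q ^ k * pathGF q (suc m) (suc h) k + withFirstPeak q (pathGF q m h) k + q ^ k * pathGF q (suc m) (h ∸ 1) k
pathGF-rec q m h k = begin
  pathGF q (suc (suc m)) h k + Q * (Q * pathGF q m h k)
    ≡⟨ cong (_+ Q * (Q * pathGF q m h k))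
            (trans (pathGF-suc q (suc m) h k) (cong (_+ Q * pathGF q (suc m) (h ∸ 1) k) (pathGF-U-suc q m h k))) ⟩
  Q * pathGF-U q m (suc h) k + W + Q * pathGF q (suc m) (h ∸ 1) k + Q * (Q * pathGF q m h k)
    ≡⟨ regroup Q (pathGF-U q m (suc h) k) W (pathGF q (suc m) (h ∸ 1) k) (Q * pathGF q m h k) ⟩
  Q * (pathGF-U q m (suc h) k + Q * pathGF q m h k) + W + Q * pathGF q (suc m) (h ∸ 1) k
    ≡⟨ cong (λ z → Q * z + W + Q * pathGF q (suc m) (h ∸ 1) k) (sym (pathGF-suc q m (suc h) k)) ⟩
  Q * pathGF q (suc m) (suc h) k + W + Q * pathGF q (suc m) (h ∸ 1) k ∎
  where
  open ≡-Reasoning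
  Q W : ℕ
  Q = q ^ k
  W = withFirstPeak q (pathGF q m h) k
  regroup : ∀ a b c d e → a * b + c + a * d + a * e ≡ a * (b + e) + c + a * d
  regroup = solve-∀

pathGF-U-empty : ∀ q {m h} k → m ≤ h → pathGF-U q m h k ≡ 0
pathGF-U-empty q {m} {h} k m≤h rewrite paths-empty {m} {suc h} (s≤s m≤h) = refl

pathGF-diag : ∀ q h k → pathGF q h h k ≡ δ₀ k
pathGF-diag q zero    zero    = refl
pathGF-diag q zero    (suc k) = refl
pathGF-diag q (suc h) k
  rewrite pathGF-suc q h (suc h) k | pathGF-U-empty q k (n≤1+n h) | pathGF-diag q h k = ^*δ₀ q k

pathGF-subdiag : ∀ q h k → pathGF q (suc h) h k ≡ δ₀ k
pathGF-subdiag q zero    k rewrite pathGF-suc q 0 0 k | pathGF-diag q 0 k = ^*δ₀ q k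
pathGF-subdiag q (suc h) k
  rewrite pathGF-suc q (suc h) (suc h) k | pathGF-U-empty q k (≤-refl {suc h}) | pathGF-subdiag q h k = ^*δ₀ q k

ClosedForm : ℕ → ℕ → Set
ClosedForm q e = ∀ h k → pathGF q (e + h) h k ≡ qbinProd q (⌈ e /2⌉ + h) ⌊ e /2⌋ k

-- Both sides satisfy the recurrences pathGF-rec / qbinProd-rec, which determine them
-- from the values two steps earlier.
closedForm-step : ∀ q e → ClosedForm q e → ClosedForm q (suc e) → ClosedForm q (suc (suc e))
closedForm-step q e CFe CFe+1 = go
  where
  a : ℕ → ℕ
  a h = ⌈ e /2⌉ + h
  b : ℕ
  b = ⌊ e /2⌋
  go : ∀ h k → pathGF q (suc (suc e) + h) h k ≡ qbinProd q (suc (a h)) (suc b) k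
  lower : ∀ h k → pathGF q (suc (e + h)) (h ∸ 1) k ≡ qbinProd q (a h) (suc b) k
  go h k = +-cancelʳ-≡ (q ^ k * (q ^ k * qbinProd q (a h) b k)) _ _ (begin
    pathGF q (suc (suc e) + h) h k + q ^ k * (q ^ k * qbinProd q (a h) b k)
      ≡⟨ cong (λ z → pathGF q (suc (suc e) + h) h k + q ^ k * (q ^ k * z)) (sym (CFe h k)) ⟩
    pathGF q (suc (suc (e + h))) h k + q ^ k * (q ^ k * pathGF q (e + h) h k)
      ≡⟨ pathGF-rec q (e + h) h k ⟩
    q ^ k * pathGF q (suc (e + h)) (suc h) k + withFirstPeak q (pathGF q (e + h) h) k
      + q ^ k * pathGF q (suc (e + h)) (h ∸ 1) k
      ≡⟨ cong₂ (λ x y → q ^ k * x + y + q ^ k * pathGF q (suc (e + h)) (h ∸ 1) k) upper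
               (withFirstPeak-cong q (CFe h) k) ⟩
    q ^ k * qbinProd q (suc (a h)) b k + withFirstPeak q (qbinProd q (a h) b) k
      + q ^ k * pathGF q (suc (e + h)) (h ∸ 1) k
      ≡⟨ cong (λ z → q ^ k * qbinProd q (suc (a h)) b k + withFirstPeak q (qbinProd q (a h) b) k + q ^ k * z)
              (lower h k) ⟩
    q ^ k * qbinProd q (suc (a h)) b k + withFirstPeak q (qbinProd q (a h) b) k
      + q ^ k * qbinProd q (a h) (suc b) k
      ≡⟨ sym (qbinProd-rec q (a h) b k) ⟩
    qbinProd q (suc (a h)) (suc b) k + q ^ k * (q ^ k * qbinProd q (a h) b k) ∎)
    where
    open ≡-Reasoning
    upper : pathGF q (suc (e + h)) (suc h) k ≡ qbinProd q (suc (a h)) b k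
    upper = trans (cong (λ z → pathGF q z (suc h) k) (sym (+-suc e h)))
                  (trans (CFe (suc h) k) (cong (λ z → qbinProd q z b k) (+-suc ⌈ e /2⌉ h)))
  lower zero    k = begin
    pathGF q (suc (e + 0)) 0 k                  ≡⟨ CFe+1 0 k ⟩
    qbinProd q (suc ⌊ e /2⌋ + 0) ⌈ e /2⌉ k     ≡⟨ cong (λ z → qbinProd q z ⌈ e /2⌉ k) (+-identityʳ (suc b)) ⟩
    qbinProd q (suc b) ⌈ e /2⌉ k               ≡⟨ qbinProd-comm q (suc b) ⌈ e /2⌉ k ⟩
    qbinProd q ⌈ e /2⌉ (suc b) k               ≡⟨ cong (λ z → qbinProd q z (suc b) k) (sym (+-identityʳ ⌈ e /2⌉)) ⟩
    qbinProd q (a 0) (suc b) k                 ∎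
    where open ≡-Reasoning
  lower (suc h) k = begin
    pathGF q (suc (e + suc h)) h k             ≡⟨ cong (λ z → pathGF q (suc z) h k) (+-suc e h) ⟩
    pathGF q (suc (suc e) + h) h k             ≡⟨ go h k ⟩
    qbinProd q (suc (a h)) (suc b) k          ≡⟨ cong (λ z → qbinProd q z (suc b) k) (sym (+-suc ⌈ e /2⌉ h)) ⟩
    qbinProd q (a (suc h)) (suc b) k          ∎
    where open ≡-Reasoning

closedForm : ∀ q e → ClosedForm q e × ClosedForm q (suc e)
closedForm q zero    = (λ h k → trans (pathGF-diag q h k) (sym (qbinProd-0 q h k)))
                     , (λ h k → trans (pathGF-subdiag q h k) (sym (qbinProd-0 q (suc h) k)))
closedForm q (suc e) = let (CFe , CFe+1) = closedForm q e in CFe+1 , closedForm-step q e CFe CFe+1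

pathGF-closed : ∀ q m k → pathGF q m 0 k ≡ qbinProd q ⌈ m /2⌉ ⌊ m /2⌋ k
pathGF-closed q m k = begin
  pathGF q m 0 k                              ≡⟨ cong (λ z → pathGF q z 0 k) (sym (+-identityʳ m)) ⟩
  pathGF q (m + 0) 0 k                        ≡⟨ proj₁ (closedForm q m) 0 k ⟩
  qbinProd q (⌈ m /2⌉ + 0) ⌊ m /2⌋ k         ≡⟨ cong (λ z → qbinProd q z ⌊ m /2⌋ k) (+-identityʳ ⌈ m /2⌉) ⟩
  qbinProd q ⌈ m /2⌉ ⌊ m /2⌋ k               ∎
  where open ≡-Reasoning

sumOf-peakMaj-paths : ∀ q c h m {N} → m < N →
  sumOf (peakMaj q (c + 1)) (paths h m) ≡ sumOf (λ k → q ^ (c * k) * pathGF q m h k) (upTo N)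
sumOf-peakMaj-paths q c h m {N} m<N = begin
  sumOf (peakMaj q (c + 1)) (paths h m)
    ≡⟨ sumOf-cong∈ (paths h m) (λ w w∈ → peakMaj-by-peaks q c w
         (≤-<-trans (length-peaks 1 w) (subst (_< N) (sym (proj₂ (∈paths⇒IsPath h m w∈))) m<N))) ⟩
  sumOf (λ w → sumOf (λ k → q ^ (c * k) * peakWeight q k 1 w) (upTo N)) (paths h m)
    ≡⟨ sumOf-swap (λ k w → q ^ (c * k) * peakWeight q k 1 w) (upTo N) (paths h m) ⟩
  sumOf (λ k → sumOf (λ w → q ^ (c * k) * peakWeight q k 1 w) (paths h m)) (upTo N)
    ≡⟨ sumOf-cong (λ k → sumOf-*ˡ (q ^ (c * k)) (peakWeight q k 1) (paths h m)) (upTo N) ⟩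
  sumOf (λ k → q ^ (c * k) * pathGF q m h k) (upTo N) ∎
  where open ≡-Reasoning

-- Paths by their initial run of up steps

initialUps : List Step → ℕ
initialUps (U ∷ w) = suc (initialUps w)
initialUps _       = 0

restrictUps : ℕ → ℕ → ℕ → List Step → ℕ
restrictUps q u i w = if initialUps w ≡ᵇ u then peakMaj q i w else 0

pathLeadGF : ℕ → ℕ → ℕ → ℕ
pathLeadGF q n u = sumOf (restrictUps q u 1) (paths 0 n)

sumOf-restrictUps-suc : ∀ q u i h m →
  sumOf (restrictUps q (suc u) i) (paths h (suc m)) ≡ sumOf (restrictUps q (suc u) i ∘ (U ∷_)) (paths (suc h) m)
sumOf-restrictUps-suc q u i zero m =
  trans (sumOf-++ (restrictUps q (suc u) i) (map (U ∷_) (paths 1 m)) _)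
        (trans (cong₂ _+_ (sumOf-map (restrictUps q (suc u) i) (U ∷_) (paths 1 m))
                          (trans (sumOf-map (restrictUps q (suc u) i) (F ∷_) (paths 0 m)) (sumOf-zero (paths 0 m))))
               (+-identityʳ _))
sumOf-restrictUps-suc q u i (suc h) m =
  trans (sumOf-++ (restrictUps q (suc u) i) (map (U ∷_) (paths (suc (suc h)) m)) _)
        (trans (cong₂ _+_ (sumOf-map (restrictUps q (suc u) i) (U ∷_) (paths (suc (suc h)) m))
                          (trans (sumOf-map (restrictUps q (suc u) i) (D ∷_) (paths h m)) (sumOf-zero (paths h m))))
               (+-identityʳ _))

-- A path with exactly j + 1 initial up steps is U^(j+1) D followed by a path from height j,
-- whose peaks are shifted by j + 2.
sumOf-restrictUps : ∀ q j h m i →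
  sumOf (restrictUps q (suc j) i) (paths h (suc j + suc m)) ≡ q ^ (j + i) * sumOf (peakMaj q (suc (suc j + i))) (paths (j + h) m)
sumOf-restrictUps q zero h m i = begin
  sumOf (restrictUps q 1 i) (paths h (suc (suc m)))
    ≡⟨ sumOf-restrictUps-suc q 0 i h (suc m) ⟩
  sumOf (restrictUps q 1 i ∘ (U ∷_)) (map (U ∷_) (paths (suc (suc h)) m) ++ map (D ∷_) (paths h m))
    ≡⟨ sumOf-++ (restrictUps q 1 i ∘ (U ∷_)) (map (U ∷_) (paths (suc (suc h)) m)) _ ⟩
  sumOf (restrictUps q 1 i ∘ (U ∷_)) (map (U ∷_) (paths (suc (suc h)) m))
    + sumOf (restrictUps q 1 i ∘ (U ∷_)) (map (D ∷_) (paths h m))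
    ≡⟨ cong₂ _+_ (trans (sumOf-map (restrictUps q 1 i ∘ (U ∷_)) (U ∷_) (paths (suc (suc h)) m))
                        (sumOf-zero (paths (suc (suc h)) m)))
                 (sumOf-map (restrictUps q 1 i ∘ (U ∷_)) (D ∷_) (paths h m)) ⟩
  0 + sumOf (λ w → peakMaj q i (U ∷ D ∷ w)) (paths h m)
    ≡⟨ sumOf-cong peakMaj-UD (paths h m) ⟩
  sumOf (λ w → q ^ i * peakMaj q (suc (suc i)) w) (paths h m)
    ≡⟨ sumOf-*ˡ (q ^ i) (peakMaj q (suc (suc i))) (paths h m) ⟩
  q ^ i * sumOf (peakMaj q (suc (suc i))) (paths h m) ∎
  where
  open ≡-Reasoning
  peakMaj-UD : ∀ w → peakMaj q i (U ∷ D ∷ w) ≡ q ^ i * peakMaj q (suc (suc i)) w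
  peakMaj-UD w = trans (^-distribˡ-+-* q i (sum (peaks (suc i) (D ∷ w))))
                       (cong (λ p → q ^ i * q ^ sum p) (peaks-D (suc i) w))
sumOf-restrictUps q (suc j) h m i = begin
  sumOf (restrictUps q (suc (suc j)) i) (paths h (suc (suc j + suc m)))
    ≡⟨ sumOf-restrictUps-suc q (suc j) i h (suc j + suc m) ⟩
  sumOf (restrictUps q (suc (suc j)) i ∘ (U ∷_)) (paths (suc h) (suc j + suc m))
    ≡⟨ sumOf-cong peel-U (paths (suc h) (suc j + suc m)) ⟩
  sumOf (restrictUps q (suc j) (suc i)) (paths (suc h) (suc j + suc m))
    ≡⟨ sumOf-restrictUps q j (suc h) m (suc i) ⟩
  q ^ (j + suc i) * sumOf (peakMaj q (suc (suc j + suc i))) (paths (j + suc h) m)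
    ≡⟨ cong₂ (λ a b → q ^ a * sumOf (peakMaj q (suc (suc a))) (paths b m)) (+-suc j i) (+-suc j h) ⟩
  q ^ (suc j + i) * sumOf (peakMaj q (suc (suc (suc j) + i))) (paths (suc j + h) m) ∎
  where
  open ≡-Reasoning
  peel-U : ∀ w → restrictUps q (suc (suc j)) i (U ∷ w) ≡ restrictUps q (suc j) (suc i) w
  peel-U []      = refl
  peel-U (U ∷ w) = refl
  peel-U (D ∷ w) = refl
  peel-U (F ∷ w) = refl

pathLeadGF-F : ∀ q m → pathLeadGF q (suc m) 0 ≡ leadRHS q (suc m) 1
pathLeadGF-F q m = begin
  pathLeadGF q (suc m) 0
    ≡⟨ sumOf-++ (restrictUps q 0 1) (map (U ∷_) (paths 1 m)) (map (F ∷_) (paths 0 m)) ⟩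
  sumOf (restrictUps q 0 1) (map (U ∷_) (paths 1 m)) + sumOf (restrictUps q 0 1) (map (F ∷_) (paths 0 m))
    ≡⟨ cong₂ _+_ (trans (sumOf-map (restrictUps q 0 1) (U ∷_) (paths 1 m)) (sumOf-zero (paths 1 m)))
                 (sumOf-map (restrictUps q 0 1) (F ∷_) (paths 0 m)) ⟩
  sumOf (λ w → peakMaj q 1 (F ∷ w)) (paths 0 m)
    ≡⟨ sumOf-cong (λ w → cong (λ p → q ^ sum p) (peaks-F 1 w)) (paths 0 m) ⟩
  sumOf (peakMaj q (1 + 1)) (paths 0 m)
    ≡⟨ sumOf-peakMaj-paths q 1 0 m (m<n⇒m<1+n (n<1+n m)) ⟩
  sumOf (λ k → q ^ (1 * k) * pathGF q m 0 k) (upTo (suc (suc m)))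
    ≡⟨ sumOf-cong summand (upTo (suc (suc m))) ⟩
  leadRHS q (suc m) 1 ∎
  where
  open ≡-Reasoning
  summand : ∀ k → q ^ (1 * k) * pathGF q m 0 k
    ≡ q ^ (k * k + k * 1 + 1 ∸ 1) * qbinom q (⌈ suc m /2⌉ ∸ 1) k * qbinom q (⌊ suc m /2⌋ + 1 ∸ 1) k
  summand k = begin
    q ^ (1 * k) * pathGF q m 0 k
      ≡⟨ cong (q ^ (1 * k) *_) (trans (pathGF-closed q m k) (qbinProd-comm q ⌈ m /2⌉ ⌊ m /2⌋ k)) ⟩
    q ^ (1 * k) * qbinProd q ⌊ m /2⌋ ⌈ m /2⌉ k
      ≡⟨ sym (*-identityˡ _) ⟩
    q ^ 0 * (q ^ (1 * k) * qbinProd q ⌊ m /2⌋ ⌈ m /2⌉ k)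
      ≡⟨ qbinProd-scaled q ⌊ m /2⌋ ⌈ m /2⌉ 1 0 k ⟩
    q ^ (k * k + k * 1 + 0) * qbin q ⌊ m /2⌋ k * qbin q ⌈ m /2⌉ k
      ≡⟨ cong₂ (λ x y → q ^ x * qbin q ⌊ m /2⌋ k * qbin q y k)
               (trans (+-identityʳ _) (sym (m+n∸n≡m (k * k + k * 1) 1))) (sym (m+n∸n≡m ⌈ m /2⌉ 1)) ⟩
    q ^ (k * k + k * 1 + 1 ∸ 1) * qbin q ⌊ m /2⌋ k * qbin q (⌈ m /2⌉ + 1 ∸ 1) k
      ≡⟨ sym (cong₂ (λ x y → q ^ (k * k + k * 1 + 1 ∸ 1) * x * y)
                    (qbinom≡qbin q ⌊ m /2⌋ k) (qbinom≡qbin q (⌈ m /2⌉ + 1 ∸ 1) k)) ⟩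
    q ^ (k * k + k * 1 + 1 ∸ 1) * qbinom q ⌊ m /2⌋ k * qbinom q (⌈ m /2⌉ + 1 ∸ 1) k ∎

⌊j+j+e/2⌋≡j+⌊e/2⌋ : ∀ j e → ⌊ j + j + e /2⌋ ≡ j + ⌊ e /2⌋
⌊j+j+e/2⌋≡j+⌊e/2⌋ zero    e = refl
⌊j+j+e/2⌋≡j+⌊e/2⌋ (suc j) e rewrite +-suc j j = cong suc (⌊j+j+e/2⌋≡j+⌊e/2⌋ j e)

⌈j+j+e/2⌉≡j+⌈e/2⌉ : ∀ j e → ⌈ j + j + e /2⌉ ≡ j + ⌈ e /2⌉
⌈j+j+e/2⌉≡j+⌈e/2⌉ j e = trans (cong ⌊_/2⌋ (sym (+-suc (j + j) e))) (⌊j+j+e/2⌋≡j+⌊e/2⌋ j (suc e))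

pathLeadGF-U : ∀ q j e → pathLeadGF q (2 + (j + j + e)) (suc j) ≡ leadRHS q (2 + (j + j + e)) (2 + j)
pathLeadGF-U q j e = begin
  sumOf (restrictUps q (suc j) 1) (paths 0 n)
    ≡⟨ cong (λ z → sumOf (restrictUps q (suc j) 1) (paths 0 z)) n≡ ⟩
  sumOf (restrictUps q (suc j) 1) (paths 0 (suc j + suc (j + e)))
    ≡⟨ sumOf-restrictUps q j 0 (j + e) 1 ⟩
  q ^ (j + 1) * sumOf (peakMaj q (ℓ + 1)) (paths (j + 0) (j + e))
    ≡⟨ cong (λ z → q ^ (j + 1) * sumOf (peakMaj q (ℓ + 1)) (paths z (j + e))) (+-identityʳ j) ⟩
  q ^ (j + 1) * sumOf (peakMaj q (ℓ + 1)) (paths j (j + e))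
    ≡⟨ cong (q ^ (j + 1) *_) (sumOf-peakMaj-paths q ℓ j (j + e) j+e<n+1) ⟩
  q ^ (j + 1) * sumOf (λ k → q ^ (ℓ * k) * pathGF q (j + e) j k) (upTo (suc n))
    ≡⟨ sym (sumOf-*ˡ (q ^ (j + 1)) _ (upTo (suc n))) ⟩
  sumOf (λ k → q ^ (j + 1) * (q ^ (ℓ * k) * pathGF q (j + e) j k)) (upTo (suc n))
    ≡⟨ sumOf-cong summand (upTo (suc n)) ⟩
  leadRHS q n ℓ ∎
  where
  open ≡-Reasoning
  n ℓ : ℕ
  n = 2 + (j + j + e)
  ℓ = 2 + j
  n≡ : n ≡ suc j + suc (j + e)
  n≡ = cong suc (trans (cong suc (+-assoc j j e)) (sym (+-suc j (j + e))))
  j+e<n+1 : j + e < suc n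
  j+e<n+1 = s≤s (≤-trans (+-monoˡ-≤ e (m≤m+n j j)) (≤-trans (n≤1+n _) (n≤1+n _)))
  ⌈n/2⌉∸1 : ⌈ n /2⌉ ∸ 1 ≡ j + ⌈ e /2⌉
  ⌈n/2⌉∸1 = ⌈j+j+e/2⌉≡j+⌈e/2⌉ j e
  ⌊n/2⌋+1∸ℓ : ⌊ n /2⌋ + 1 ∸ ℓ ≡ ⌊ e /2⌋
  ⌊n/2⌋+1∸ℓ = trans (cong (_∸ suc j) (+-comm ⌊ j + j + e /2⌋ 1))
                    (trans (cong (_∸ j) (⌊j+j+e/2⌋≡j+⌊e/2⌋ j e)) (m+n∸m≡n j ⌊ e /2⌋))
  exponent : ∀ k → k * k + k * ℓ + (j + 1) ≡ k * k + k * ℓ + ℓ ∸ 1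
  exponent k = trans (cong (k * k + k * ℓ +_) (+-comm j 1)) (cong (_∸ 1) (sym (+-suc (k * k + k * ℓ) (suc j))))
  summand : ∀ k → q ^ (j + 1) * (q ^ (ℓ * k) * pathGF q (j + e) j k)
    ≡ q ^ (k * k + k * ℓ + ℓ ∸ 1) * qbinom q (⌈ n /2⌉ ∸ 1) k * qbinom q (⌊ n /2⌋ + 1 ∸ ℓ) k
  summand k = begin
    q ^ (j + 1) * (q ^ (ℓ * k) * pathGF q (j + e) j k)
      ≡⟨ cong (λ z → q ^ (j + 1) * (q ^ (ℓ * k) * z)) closed ⟩
    q ^ (j + 1) * (q ^ (ℓ * k) * qbinProd q (j + ⌈ e /2⌉) ⌊ e /2⌋ k)
      ≡⟨ qbinProd-scaled q (j + ⌈ e /2⌉) ⌊ e /2⌋ ℓ (j + 1) k ⟩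
    q ^ (k * k + k * ℓ + (j + 1)) * qbin q (j + ⌈ e /2⌉) k * qbin q ⌊ e /2⌋ k
      ≡⟨ cong (λ x → q ^ x * qbin q (j + ⌈ e /2⌉) k * qbin q ⌊ e /2⌋ k) (exponent k) ⟩
    q ^ (k * k + k * ℓ + ℓ ∸ 1) * qbin q (j + ⌈ e /2⌉) k * qbin q ⌊ e /2⌋ k
      ≡⟨ sym (cong₂ (λ x y → q ^ (k * k + k * ℓ + ℓ ∸ 1) * x * y)
                    (trans (qbinom≡qbin q _ k) (cong (λ z → qbin q z k) ⌈n/2⌉∸1))
                    (trans (qbinom≡qbin q _ k) (cong (λ z → qbin q z k) ⌊n/2⌋+1∸ℓ))) ⟩
    q ^ (k * k + k * ℓ + ℓ ∸ 1) * qbinom q (⌈ n /2⌉ ∸ 1) k * qbinom q (⌊ n /2⌋ + 1 ∸ ℓ) k ∎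
    where
    closed : pathGF q (j + e) j k ≡ qbinProd q (j + ⌈ e /2⌉) ⌊ e /2⌋ k
    closed = trans (cong (λ z → pathGF q z j k) (+-comm j e))
                   (trans (proj₁ (closedForm q e) j k) (cong (λ z → qbinProd q z ⌊ e /2⌋ k) (+-comm ⌈ e /2⌉ j)))

j<⌊n/2⌋⇒n≡2+j+j+e : ∀ j n → suc j ≤ ⌊ n /2⌋ → Σ ℕ (λ e → n ≡ 2 + (j + j + e))
j<⌊n/2⌋⇒n≡2+j+j+e zero    (suc (suc n)) _ = n , refl
j<⌊n/2⌋⇒n≡2+j+j+e (suc j) (suc (suc n)) (s≤s j<⌊n/2⌋) with j<⌊n/2⌋⇒n≡2+j+j+e j n j<⌊n/2⌋
... | e , refl = e , cong (λ z → 3 + (z + e)) (sym (+-suc j j))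

pathLeadGF-closed : ∀ q n u → 1 ≤ n → suc u ≤ ⌊ n /2⌋ + 1 → pathLeadGF q n u ≡ leadRHS q n (suc u)
pathLeadGF-closed q (suc m) zero    _ _  = pathLeadGF-F q m
pathLeadGF-closed q n       (suc j) _ ℓ≤ with j<⌊n/2⌋⇒n≡2+j+j+e j n (s≤s⁻¹ (subst (suc (suc j) ≤_) (+-comm ⌊ n /2⌋ 1) ℓ≤))
... | e , refl = pathLeadGF-U q j e

-- From involutions to paths

nth : List ℕ → ℕ → ℕ
nth []      i       = 0
nth (x ∷ L) zero    = x
nth (x ∷ L) (suc i) = nth L i

stepAt : List Step → ℕ → Step
stepAt []      i       = F
stepAt (s ∷ w) zero    = s
stepAt (s ∷ w) (suc i) = stepAt w i

nth-ext : ∀ (A B : List ℕ) → length A ≡ length B → (∀ p → p < length A → nth A p ≡ nth B p) → A ≡ B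
nth-ext []      []      _   _     = refl
nth-ext (a ∷ A) (b ∷ B) len nth≡ = cong₂ _∷_ (nth≡ 0 z<s) (nth-ext A B (suc-injective len) (λ p p<l → nth≡ (suc p) (s≤s p<l)))

record Involution321 (n : ℕ) (L : List ℕ) : Set where
  field
    length≡    : length L ≡ n
    bounded    : ∀ i → i < n → nth L i < n
    involutive : ∀ i → i < n → nth L (nth L i) ≡ i
    avoids321  : ∀ i j k → i < j → j < k → k < n → nth L k < nth L j → nth L j < nth L i → ⊥

  injective : ∀ i j → i < n → j < n → nth L i ≡ nth L j → i ≡ j
  injective i j i<n j<n Li≡Lj = trans (sym (involutive i i<n)) (trans (cong (nth L) Li≡Lj) (involutive j j<n))

<⇒<ᵇ≡true : ∀ {m n} → m < n → (m <ᵇ n) ≡ true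
<⇒<ᵇ≡true {m} {n} m<n with m <ᵇ n | <⇒<ᵇ m<n
... | true | _ = refl

≮⇒<ᵇ≡false : ∀ {m n} → ¬ m < n → (m <ᵇ n) ≡ false
≮⇒<ᵇ≡false {m} {n} m≮n with m <ᵇ n | <ᵇ⇒< m n
... | true  | sound = ⊥-elim (m≮n (sound tt))
... | false | _     = refl

stepType : ℕ → ℕ → Step
stepType x p with <-cmp x p
... | tri< _ _ _ = D
... | tri≈ _ _ _ = F
... | tri> _ _ _ = U

stepType-< : ∀ {x p} → x < p → stepType x p ≡ D
stepType-< {x} {p} x<p with <-cmp x p
... | tri< _ _ _  = refl
... | tri≈ x≮p _ _ = ⊥-elim (x≮p x<p)
... | tri> x≮p _ _ = ⊥-elim (x≮p x<p)

stepType-≡ : ∀ {x p} → x ≡ p → stepType x p ≡ F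
stepType-≡ {x} {p} x≡p with <-cmp x p
... | tri< _ x≢p _ = ⊥-elim (x≢p x≡p)
... | tri≈ _ _ _   = refl
... | tri> _ x≢p _ = ⊥-elim (x≢p x≡p)

stepType-> : ∀ {x p} → p < x → stepType x p ≡ U
stepType-> {x} {p} p<x with <-cmp x p
... | tri< _ _ p≮x = ⊥-elim (p≮x p<x)
... | tri≈ _ _ p≮x = ⊥-elim (p≮x p<x)
... | tri> _ _ _   = refl

stepType≡D⇒< : ∀ {x p} → stepType x p ≡ D → x < p
stepType≡D⇒< {x} {p} eq with <-cmp x p
stepType≡D⇒< {x} {p} eq | tri< x<p _ _ = x<p
stepType≡D⇒< {x} {p} () | tri≈ _ _ _
stepType≡D⇒< {x} {p} () | tri> _ _ _

stepType≡F⇒≡ : ∀ {x p} → stepType x p ≡ F → x ≡ p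
stepType≡F⇒≡ {x} {p} eq with <-cmp x p
stepType≡F⇒≡ {x} {p} () | tri< _ _ _
stepType≡F⇒≡ {x} {p} eq | tri≈ _ x≡p _ = x≡p
stepType≡F⇒≡ {x} {p} () | tri> _ _ _

stepType≡U⇒> : ∀ {x p} → stepType x p ≡ U → p < x
stepType≡U⇒> {x} {p} eq with <-cmp x p
stepType≡U⇒> {x} {p} () | tri< _ _ _
stepType≡U⇒> {x} {p} () | tri≈ _ _ _
stepType≡U⇒> {x} {p} eq | tri> _ _ p<x = p<x

stepTypes : ℕ → List ℕ → List Step
stepTypes p []      = []
stepTypes p (x ∷ L) = stepType x p ∷ stepTypes (suc p) L

length-stepTypes : ∀ p L → length (stepTypes p L) ≡ length L
length-stepTypes p []      = refl
length-stepTypes p (x ∷ L) = cong suc (length-stepTypes (suc p) L)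

stepAt-stepTypes : ∀ p L t → t < length L → stepAt (stepTypes p L) t ≡ stepType (nth L t) (p + t)
stepAt-stepTypes p (x ∷ L) zero    _         = cong (stepType x) (sym (+-identityʳ p))
stepAt-stepTypes p (x ∷ L) (suc t) (s≤s t<l) =
  trans (stepAt-stepTypes (suc p) L t t<l) (cong (stepType (nth L t)) (sym (+-suc p t)))

module _ {n L} (σ : Involution321 n L) where
  open Involution321 σ

  -- Of the nine combinations of step types at p and p + 1, only UD yields a descent; the others
  -- give an ascent or contradict involutivity or 321-avoidance.
  descent≡peak : ∀ p → suc p < n →
    (nth L (suc p) <ᵇ nth L p) ≡ isPeak (stepType (nth L p) p) (stepType (nth L (suc p)) (suc p))
  descent≡peak p p+1<n with <-cmp (nth L p) p | <-cmp (nth L (suc p)) (suc p)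
  ... | tri> _ _ x>p | tri> _ _ y>p+1 = ≮⇒<ᵇ≡false λ y<x →
        avoids321 p (suc p) (nth L (suc p)) (n<1+n p) y>p+1 (bounded _ p+1<n)
          (subst (_< nth L (suc p)) (sym (involutive (suc p) p+1<n)) y>p+1) y<x
  ... | tri> _ _ x>p | tri< y<p+1 _ _ = <⇒<ᵇ≡true (≤-<-trans (s≤s⁻¹ y<p+1) x>p)
  ... | tri> _ _ x>p | tri≈ _ y≡p+1 _ = ⊥-elim
        (avoids321 p (suc p) (nth L p) (n<1+n p) x>p+1 (bounded p p<n)
          (subst₂ _<_ (sym (involutive p p<n)) (sym y≡p+1) (n<1+n p))
          (subst (_< nth L p) (sym y≡p+1) x>p+1))
    where
    p<n : p < n
    p<n = <-trans (n<1+n p) p+1<n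
    x>p+1 : suc p < nth L p
    x>p+1 = ≤∧≢⇒< x>p λ p+1≡x → <-irrefl (injective p (suc p) p<n p+1<n (trans (sym p+1≡x) (sym y≡p+1))) (n<1+n p)
  ... | tri< x<p _ _ | tri> _ _ y>p+1 = ≮⇒<ᵇ≡false λ y<x → <-asym y<x (<-trans x<p (<-trans (n<1+n p) y>p+1))
  ... | tri< x<p _ _ | tri< y<p+1 _ _ = ≮⇒<ᵇ≡false λ y<x →
        avoids321 (nth L (suc p)) (nth L p) (suc p) y<x (<-trans x<p (n<1+n p)) p+1<n
          (subst (nth L (suc p) <_) (sym (involutive p p<n)) (<-trans y<x x<p))
          (subst₂ _<_ (sym (involutive p p<n)) (sym (involutive (suc p) p+1<n)) (n<1+n p))
    where
    p<n : p < n
    p<n = <-trans (n<1+n p) p+1<n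
  ... | tri< x<p _ _ | tri≈ _ y≡p+1 _ = ≮⇒<ᵇ≡false λ y<x →
        <-asym y<x (subst (nth L p <_) (sym y≡p+1) (<-trans x<p (n<1+n p)))
  ... | tri≈ _ x≡p _ | tri> _ _ y>p+1 = ≮⇒<ᵇ≡false λ y<x →
        <-asym y<x (subst (_< nth L (suc p)) (sym x≡p) (<-trans (n<1+n p) y>p+1))
  ... | tri≈ _ x≡p _ | tri< y<p+1 _ _ = ⊥-elim
        (avoids321 (nth L (suc p)) p (suc p) y<p (n<1+n p) p+1<n
          (subst (nth L (suc p) <_) (sym x≡p) y<p)
          (subst₂ _<_ (sym x≡p) (sym (involutive (suc p) p+1<n)) (n<1+n p)))
    where
    p<n : p < n
    p<n = <-trans (n<1+n p) p+1<n
    y<p : nth L (suc p) < p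
    y<p = ≤∧≢⇒< (s≤s⁻¹ y<p+1) λ y≡p → <-irrefl (injective p (suc p) p<n p+1<n (trans x≡p (sym y≡p))) (n<1+n p)
  ... | tri≈ _ x≡p _ | tri≈ _ y≡p+1 _ = ≮⇒<ᵇ≡false λ y<x →
        <-asym y<x (subst₂ _<_ (sym x≡p) (sym y≡p+1) (n<1+n p))

descents≡peaks : ∀ i p L → (∀ t → suc t < length L →
    (nth L (suc t) <ᵇ nth L t) ≡ isPeak (stepType (nth L t) (p + t)) (stepType (nth L (suc t)) (p + suc t)))
  → descents i L ≡ peaks i (stepTypes p L)
descents≡peaks i p []           _    = refl
descents≡peaks i p (a ∷ [])     _    = refl
descents≡peaks i p (a ∷ b ∷ L) local =
  step (b <ᵇ a) (isPeak (stepType a p) (stepType b (suc p))) first (descents≡peaks (suc i) (suc p) (b ∷ L) rest)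
  where
  first : (b <ᵇ a) ≡ isPeak (stepType a p) (stepType b (suc p))
  first = trans (local 0 (s≤s (s≤s z≤n)))
                (cong₂ (λ u v → isPeak (stepType a u) (stepType b v)) (+-identityʳ p) (trans (+-suc p 0) (cong suc (+-identityʳ p))))
  rest : ∀ t → suc t < length (b ∷ L) →
    (nth (b ∷ L) (suc t) <ᵇ nth (b ∷ L) t) ≡ isPeak (stepType (nth (b ∷ L) t) (suc p + t)) (stepType (nth (b ∷ L) (suc t)) (suc p + suc t))
  rest t t+1<l = trans (local (suc t) (s≤s t+1<l))
    (cong₂ (λ u v → isPeak (stepType (nth (b ∷ L) t) u) (stepType (nth (b ∷ L) (suc t)) v)) (+-suc p t) (+-suc p (suc t)))
  step : ∀ c c′ {X Y} → c ≡ c′ → X ≡ Y → (if c then i ∷ X else X) ≡ (if c′ then i ∷ Y else Y)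
  step true  .true  refl refl = refl
  step false .false refl refl = refl

Involution321⇒descents≡peaks : ∀ {n L} → Involution321 n L → descents 1 L ≡ peaks 1 (stepTypes 0 L)
Involution321⇒descents≡peaks {L = L} σ =
  descents≡peaks 1 0 L (λ t t+1<l → descent≡peak σ t (subst (suc t <_) (Involution321.length≡ σ) t+1<l))

initialUps-≡ : ∀ w d → d < length w → (∀ t → t < d → stepAt w t ≡ U) → stepAt w d ≢ U → initialUps w ≡ d
initialUps-≡ (U ∷ w) zero    _         _     ¬U = ⊥-elim (¬U refl)
initialUps-≡ (D ∷ w) zero    _         _     _  = refl
initialUps-≡ (F ∷ w) zero    _         _     _  = refl
initialUps-≡ (s ∷ w) (suc d) (s≤s d<l) below ¬U with below 0 z<s
... | refl = cong suc (initialUps-≡ w d d<l (λ t t<d → below (suc t) (s≤s t<d)) ¬U)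

-- With x = σ 0, the positions 1, …, x - 1 all open arcs (a fixed point or a closer there
-- would form a 321 with 0 and x), and x closes the arc from 0.
head≡initialUps : ∀ {n} x L → Involution321 n (x ∷ L) → x ≡ initialUps (stepTypes 0 (x ∷ L))
head≡initialUps zero         L σ rewrite stepType-≡ {0} {0} refl = refl
head≡initialUps {n} x@(suc _) L σ =
  sym (initialUps-≡ (stepTypes 0 (x ∷ L)) x (subst (x <_) (sym (trans (length-stepTypes 0 (x ∷ L)) length≡)) x<n) opens closes)
  where
  open Involution321 σ
  0<n : 0 < n
  0<n = subst (0 <_) length≡ z<s
  x<n : x < n
  x<n = bounded 0 0<n
  σx≡0 : nth (x ∷ L) x ≡ 0
  σx≡0 = involutive 0 0<n
  opens : ∀ t → t < x → stepAt (stepTypes 0 (x ∷ L)) t ≡ U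
  opens zero    _     = stepType-> {x} {0} z<s
  opens (suc t) t+1<x rewrite stepAt-stepTypes 0 (x ∷ L) (suc t) (subst (suc t <_) (sym length≡) (<-trans t+1<x x<n))
    with <-cmp (nth L t) (suc t)
  ... | tri> _ _ _     = refl
  ... | tri≈ _ y≡t+1 _ = ⊥-elim (avoids321 0 (suc t) x z<s t+1<x x<n
                           (subst₂ _<_ (sym σx≡0) (sym y≡t+1) z<s) (subst (_< x) (sym y≡t+1) t+1<x))
  ... | tri< y<t+1 _ _ = ⊥-elim (avoids321 0 (suc t) x z<s t+1<x x<n
                           (subst (_< nth L t) (sym σx≡0) y>0) (<-trans y<t+1 t+1<x))
    where
    y>0 : 0 < nth L t
    y>0 = ≤∧≢⇒< z≤n λ 0≡y → <-irrefl (trans (sym (involutive (suc t) (<-trans t+1<x x<n))) (cong (nth (x ∷ L)) (sym 0≡y))) t+1<x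
  closes : stepAt (stepTypes 0 (x ∷ L)) x ≢ U
  closes U≡ rewrite stepAt-stepTypes 0 (x ∷ L) x (subst (x <_) (sym length≡) x<n) | σx≡0 | stepType-< {0} {x} z<s
    with U≡
  ... | ()

-- Two involutions that agree below p, with σ p > p, cannot have σ p < τ p: otherwise τ contains
-- the pattern 321 at the positions p < τ (σ p) < σ p.
stepTypes-agree-step : ∀ {n A B} → Involution321 n A → Involution321 n B →
  (∀ p → p < n → stepType (nth A p) p ≡ stepType (nth B p) p) →
  ∀ p → p < n → (∀ i → i < p → nth A i ≡ nth B i) → p < nth A p → nth A p < nth B p → ⊥
stepTypes-agree-step {n} {A} {B} σ τ types p p<n below p<σp σp<τp = case (<-cmp (nth B c) p)
  where
  module σ = Involution321 σ
  module τ = Involution321 τ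
  c : ℕ
  c = nth A p
  c<n : c < n
  c<n = σ.bounded p p<n
  case : Tri (nth B c < p) (nth B c ≡ p) (p < nth B c) → ⊥
  case (tri< c′<p _ _) = <-irrefl (σ.injective (nth B c) p (<-trans c′<p p<n) p<n
                                    (trans (below _ c′<p) (τ.involutive c c<n))) c′<p
  case (tri≈ _ c′≡p _) = <-irrefl (sym (trans (cong (nth B) (sym c′≡p)) (τ.involutive c c<n))) σp<τp
  case (tri> _ _ c′>p) = τ.avoids321 p (nth B c) c c′>p c′<c c<n
                           (subst (nth B c <_) (sym (τ.involutive c c<n)) c′<c)
                           (subst (_< nth B p) (sym (τ.involutive c c<n)) σp<τp)
    where
    c′<c : nth B c < c
    c′<c = stepType≡D⇒< (trans (sym (types c c<n)) (stepType-< (subst (_< c) (sym (σ.involutive p p<n)) p<σp)))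

stepTypes-injective : ∀ {n A B} → Involution321 n A → Involution321 n B → stepTypes 0 A ≡ stepTypes 0 B → A ≡ B
stepTypes-injective {n} {A} {B} σ τ A≈B =
  nth-ext A B (trans σ.length≡ (sym τ.length≡)) (λ p p<l → <-rec _ agree p (subst (p <_) σ.length≡ p<l))
  where
  module σ = Involution321 σ
  module τ = Involution321 τ
  types : ∀ p → p < n → stepType (nth A p) p ≡ stepType (nth B p) p
  types p p<n = trans (sym (stepAt-stepTypes 0 A p (subst (p <_) (sym σ.length≡) p<n)))
                      (trans (cong (λ w → stepAt w p) A≈B) (stepAt-stepTypes 0 B p (subst (p <_) (sym τ.length≡) p<n)))
  agree : ∀ p → (∀ {i} → i < p → i < n → nth A i ≡ nth B i) → p < n → nth A p ≡ nth B p
  agree p below p<n with <-cmp (nth A p) p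
  ... | tri≈ _ σp≡p _ = trans σp≡p (sym (stepType≡F⇒≡ (trans (sym (types p p<n)) (stepType-≡ σp≡p))))
  ... | tri< σp<p _ _ = sym (trans (cong (nth B) (sym τa≡p)) (τ.involutive a a<n))
    where
    a : ℕ
    a = nth A p
    a<n : a < n
    a<n = <-trans σp<p p<n
    τa≡p : nth B a ≡ p
    τa≡p = trans (sym (below σp<p a<n)) (σ.involutive p p<n)
  ... | tri> _ _ p<σp with <-cmp (nth A p) (nth B p)
  ...   | tri≈ _ σp≡τp _ = σp≡τp
  ...   | tri< σp<τp _ _ = ⊥-elim (stepTypes-agree-step σ τ types p p<n (λ i i<p → below i<p (<-trans i<p p<n)) p<σp σp<τp)
  ...   | tri> _ _ τp<σp = ⊥-elim (stepTypes-agree-step τ σ (λ i i<n → sym (types i i<n)) p p<n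
                             (λ i i<p → sym (below i<p (<-trans i<p p<n)))
                             (stepType≡U⇒> (trans (sym (types p p<n)) (stepType-> p<σp))) τp<σp)

ind≤ : ℕ → ℕ → ℕ
ind≤ zero    x       = 1
ind≤ (suc t) zero    = 0
ind≤ (suc t) (suc x) = ind≤ t x

ind≡ : ℕ → ℕ → ℕ
ind≡ zero    zero    = 1
ind≡ zero    (suc _) = 0
ind≡ (suc _) zero    = 0
ind≡ (suc a) (suc b) = ind≡ a b

ind≤-split : ∀ t x → ind≤ t x ≡ ind≤ (suc t) x + ind≡ x t
ind≤-split zero    zero    = refl
ind≤-split zero    (suc x) = refl
ind≤-split (suc t) zero    = refl
ind≤-split (suc t) (suc x) = ind≤-split t x

ind≤-1 : ∀ {t x} → t ≤ x → ind≤ t x ≡ 1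
ind≤-1 {zero}          _         = refl
ind≤-1 {suc t} {suc x} (s≤s t≤x) = ind≤-1 t≤x

ind≤-0 : ∀ {t x} → x < t → ind≤ t x ≡ 0
ind≤-0 {suc t} {zero}  _         = refl
ind≤-0 {suc t} {suc x} (s≤s x<t) = ind≤-0 x<t

ind≡-1 : ∀ {a b} → a ≡ b → ind≡ a b ≡ 1
ind≡-1 {zero}  refl = refl
ind≡-1 {suc a} refl = ind≡-1 {a} refl

ind≡-0 : ∀ {a b} → a ≢ b → ind≡ a b ≡ 0
ind≡-0 {zero}  {zero}  a≢b = ⊥-elim (a≢b refl)
ind≡-0 {zero}  {suc b} _   = refl
ind≡-0 {suc a} {zero}  _   = refl
ind≡-0 {suc a} {suc b} a≢b = ind≡-0 (a≢b ∘ cong suc)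

sumBelow : (ℕ → ℕ) → ℕ → ℕ
sumBelow g zero    = 0
sumBelow g (suc p) = sumBelow g p + g p

sumBelow-0 : ∀ g p → (∀ i → i < p → g i ≡ 0) → sumBelow g p ≡ 0
sumBelow-0 g zero    _    = refl
sumBelow-0 g (suc p) g≡0 rewrite sumBelow-0 g p (λ i i<p → g≡0 i (<-trans i<p (n<1+n p))) | g≡0 p (n<1+n p) = refl

nth-beyond : ∀ L i → length L ≤ i → nth L i ≡ 0
nth-beyond []      i       _         = refl
nth-beyond (x ∷ L) (suc i) (s≤s l≤i) = nth-beyond L i l≤i

drop≡∷ : ∀ (L : List ℕ) p x L′ → drop p L ≡ x ∷ L′ → nth L p ≡ x × p < length L × drop (suc p) L ≡ L′
drop≡∷ (y ∷ L) zero    x L′ refl = refl , z<s , refl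
drop≡∷ (y ∷ L) (suc p) x L′ eq   = let (Lp≡x , p<l , rest) = drop≡∷ L p x L′ eq in Lp≡x , s≤s p<l , rest

drop≡[]⇒≤ : ∀ (L : List ℕ) p → drop p L ≡ [] → length L ≤ p
drop≡[]⇒≤ []      p       _  = z≤n
drop≡[]⇒≤ (x ∷ L) (suc p) eq = s≤s (drop≡[]⇒≤ L p eq)

module _ {n L} (σ : Involution321 n L) where
  open Involution321 σ

  countAtLeast : ℕ → ℕ → ℕ
  countAtLeast p t = sumBelow (λ i → ind≤ t (nth L i)) p

  countEqual : ℕ → ℕ → ℕ
  countEqual p t = sumBelow (λ i → ind≡ (nth L i) t) p

  -- The number of arcs i ↦ σ i with i < p ≤ σ i: the height of the path after p steps.
  height : ℕ → ℕ
  height p = countAtLeast p p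

  countAtLeast-split : ∀ p t → countAtLeast p t ≡ countAtLeast p (suc t) + countEqual p t
  countAtLeast-split zero    t = refl
  countAtLeast-split (suc p) t rewrite countAtLeast-split p t | ind≤-split t (nth L p) =
    interchange (countAtLeast p (suc t)) (countEqual p t) (ind≤ (suc t) (nth L p)) (ind≡ (nth L p) t)
    where
    interchange : ∀ a b c d → a + b + (c + d) ≡ a + c + (b + d)
    interchange = solve-∀

  countEqual≡ind≤ : ∀ t → t < n → ∀ p → p ≤ n → countEqual p t ≡ ind≤ (suc (nth L t)) p
  countEqual≡ind≤ t t<n zero    _     = refl
  countEqual≡ind≤ t t<n (suc p) p<n rewrite countEqual≡ind≤ t t<n p (<⇒≤ p<n) | ind≤-split (nth L t) p =
    cong (ind≤ (suc (nth L t)) p +_) swap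
    where
    swap : ind≡ (nth L p) t ≡ ind≡ p (nth L t)
    swap with nth L p ≟ t
    ... | yes σp≡t = trans (ind≡-1 σp≡t) (sym (ind≡-1 (trans (sym (involutive p p<n)) (cong (nth L) σp≡t))))
    ... | no  σp≢t = trans (ind≡-0 σp≢t) (sym (ind≡-0 λ p≡σt → σp≢t (trans (cong (nth L) p≡σt) (involutive t t<n))))

  height-suc : ∀ p → p < n → height (suc p) + ind≤ (suc (nth L p)) p ≡ height p + ind≤ (suc p) (nth L p)
  height-suc p p<n rewrite countAtLeast-split p p | countEqual≡ind≤ p p<n p (<⇒≤ p<n) =
    swap (countAtLeast p (suc p)) (ind≤ (suc p) (nth L p)) (ind≤ (suc (nth L p)) p)
    where
    swap : ∀ a b c → a + b + c ≡ a + c + b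
    swap = solve-∀

  height-suc-< : ∀ p → p < n → nth L p < p → suc (height (suc p)) ≡ height p
  height-suc-< p p<n σp<p = begin
    suc (height (suc p))                                ≡⟨ +-comm 1 _ ⟩
    height (suc p) + 1                                  ≡⟨ cong (height (suc p) +_) (sym (ind≤-1 σp<p)) ⟩
    height (suc p) + ind≤ (suc (nth L p)) p             ≡⟨ height-suc p p<n ⟩
    height p + ind≤ (suc p) (nth L p)                   ≡⟨ cong (height p +_) (ind≤-0 (s≤s (<⇒≤ σp<p))) ⟩
    height p + 0                                        ≡⟨ +-identityʳ _ ⟩
    height p                                            ∎
    where open ≡-Reasoning

  height-suc-> : ∀ p → p < n → p < nth L p → height (suc p) ≡ suc (height p)
  height-suc-> p p<n p<σp = begin
    height (suc p)                                      ≡⟨ sym (+-identityʳ _) ⟩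
    height (suc p) + 0                                  ≡⟨ cong (height (suc p) +_) (sym (ind≤-0 (m<n⇒m<1+n p<σp))) ⟩
    height (suc p) + ind≤ (suc (nth L p)) p             ≡⟨ height-suc p p<n ⟩
    height p + ind≤ (suc p) (nth L p)                   ≡⟨ cong (height p +_) (ind≤-1 p<σp) ⟩
    height p + 1                                        ≡⟨ +-comm _ 1 ⟩
    suc (height p)                                      ∎
    where open ≡-Reasoning

  -- No arc passes over a fixed point: that would be a 321.
  height-fixed : ∀ p → p < n → nth L p ≡ p → height p ≡ 0
  height-fixed p p<n σp≡p = sumBelow-0 _ p (λ i i<p → ind≤-0 (closes-before i i<p))
    where
    closes-before : ∀ i → i < p → nth L i < p
    closes-before i i<p with <-cmp (nth L i) p
    ... | tri< σi<p _ _ = σi<p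
    ... | tri≈ _ σi≡p _ = ⊥-elim (<-irrefl (injective i p (<-trans i<p p<n) p<n (trans σi≡p (sym σp≡p))) i<p)
    ... | tri> _ _ p<σi = ⊥-elim (avoids321 i p (nth L i) i<p p<σi (bounded i (<-trans i<p p<n))
                            (subst₂ _<_ (sym (involutive i (<-trans i<p p<n))) (sym σp≡p) i<p)
                            (subst (_< nth L i) (sym σp≡p) p<σi))

  height-suc-≡ : ∀ p → p < n → nth L p ≡ p → height (suc p) ≡ 0
  height-suc-≡ p p<n σp≡p = +-cancelʳ-≡ 0 _ _ (begin
    height (suc p) + 0                          ≡⟨ cong (height (suc p) +_) (sym (ind≤-0 (subst (λ z → p < suc z) (sym σp≡p) ≤-refl))) ⟩
    height (suc p) + ind≤ (suc (nth L p)) p     ≡⟨ height-suc p p<n ⟩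
    height p + ind≤ (suc p) (nth L p)           ≡⟨ cong₂ _+_ (height-fixed p p<n σp≡p) (ind≤-0 (subst (_< suc p) (sym σp≡p) ≤-refl)) ⟩
    0 + 0                                       ∎)
    where open ≡-Reasoning

  height-end : ∀ p → n ≤ p → height p ≡ 0
  height-end p n≤p = sumBelow-0 _ p (λ i i<p → ind≤-0 (σi<p i i<p))
    where
    σi<p : ∀ i → i < p → nth L i < p
    σi<p i i<p with i <? n
    ... | yes i<n = <-≤-trans (bounded i i<n) n≤p
    ... | no  i≮n = subst (_< p) (sym (nth-beyond L i (subst (_≤ i) (sym length≡) (≮⇒≥ i≮n)))) (≤-<-trans z≤n i<p)

  IsPath-suffix : ∀ L′ p → drop p L ≡ L′ → IsPath (height p) (stepTypes p L′)
  IsPath-suffix []       p eq = height-end p (subst (_≤ p) length≡ (drop≡[]⇒≤ L p eq))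
  IsPath-suffix (x ∷ L′) p eq with drop≡∷ L p x L′ eq
  ... | σp≡x , p<l , rest with <-cmp x p
  ...   | tri< x<p _ _ =
          subst (λ h → IsPath h (D ∷ stepTypes (suc p) L′))
                (height-suc-< p (subst (p <_) length≡ p<l) (subst (_< p) (sym σp≡x) x<p))
                (IsPath-suffix L′ (suc p) rest)
  ...   | tri≈ _ x≡p _ rewrite height-fixed p (subst (p <_) length≡ p<l) (trans σp≡x x≡p) =
          refl , subst (λ h → IsPath h (stepTypes (suc p) L′))
                       (height-suc-≡ p (subst (p <_) length≡ p<l) (trans σp≡x x≡p))
                       (IsPath-suffix L′ (suc p) rest)
  ...   | tri> _ _ p<x =
          subst (λ h → IsPath h (stepTypes (suc p) L′))
                (height-suc-> p (subst (p <_) length≡ p<l) (subst (p <_) (sym σp≡x) p<x))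
                (IsPath-suffix L′ (suc p) rest)

  stepTypes∈paths : stepTypes 0 L ∈ paths 0 n
  stepTypes∈paths = subst (λ m → stepTypes 0 L ∈ paths 0 m) (trans (length-stepTypes 0 L) length≡)
                          (IsPath⇒∈paths 0 (stepTypes 0 L) (IsPath-suffix L 0 refl))

-- From paths to involutions

sameStep : Step → Step → Bool
sameStep U U = true
sameStep D D = true
sameStep F F = true
sameStep _ _ = false

sameStep-refl : ∀ X → sameStep X X ≡ true
sameStep-refl U = refl
sameStep-refl D = refl
sameStep-refl F = refl

sameStep⇒≡ : ∀ X s → sameStep X s ≡ true → s ≡ X
sameStep⇒≡ U U _ = refl
sameStep⇒≡ D D _ = refl
sameStep⇒≡ F F _ = refl
sameStep⇒≡ U D ()
sameStep⇒≡ U F ()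
sameStep⇒≡ D U ()
sameStep⇒≡ D F ()
sameStep⇒≡ F U ()
sameStep⇒≡ F D ()

indicator : Step → Step → ℕ
indicator X s = if sameStep X s then 1 else 0

indicator-≡ : ∀ X s → sameStep X s ≡ true → indicator X s ≡ 1
indicator-≡ X s eq rewrite eq = refl

indicator-≢ : ∀ X s → sameStep X s ≡ false → indicator X s ≡ 0
indicator-≢ X s eq rewrite eq = refl

rank : Step → List Step → ℕ → ℕ
rank X []      p       = 0
rank X (s ∷ w) zero    = 0
rank X (s ∷ w) (suc p) = indicator X s + rank X w p

total : Step → List Step → ℕ
total X w = rank X w (length w)

select : Step → List Step → ℕ → ℕ
select X []      r       = 0
select X (s ∷ w) zero    = if sameStep X s then 0 else suc (select X w zero)
select X (s ∷ w) (suc r) = if sameStep X s then suc (select X w r) else suc (select X w (suc r))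

select-≢ : ∀ X s w r → sameStep X s ≡ false → select X (s ∷ w) r ≡ suc (select X w r)
select-≢ X s w zero    eq rewrite eq = refl
select-≢ X s w (suc r) eq rewrite eq = refl

select-≡-zero : ∀ X s w → sameStep X s ≡ true → select X (s ∷ w) zero ≡ 0
select-≡-zero X s w eq rewrite eq = refl

select-≡-suc : ∀ X s w r → sameStep X s ≡ true → select X (s ∷ w) (suc r) ≡ suc (select X w r)
select-≡-suc X s w r eq rewrite eq = refl

select-spec : ∀ X w r → r < total X w →
  select X w r < length w × stepAt w (select X w r) ≡ X × rank X w (select X w r) ≡ r
select-spec X (s ∷ w) r r<t with sameStep X s in eq
select-spec X (s ∷ w) zero    r<t | true rewrite select-≡-zero X s w eq = z<s , sameStep⇒≡ X s eq , refl
select-spec X (s ∷ w) (suc r) r<t | true rewrite select-≡-suc X s w r eq | indicator-≡ X s eq =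
  let (<l , X≡ , rank≡) = select-spec X w r (s≤s⁻¹ r<t) in s≤s <l , X≡ , cong suc rank≡
select-spec X (s ∷ w) r       r<t | false rewrite select-≢ X s w r eq | indicator-≢ X s eq =
  let (<l , X≡ , rank≡) = select-spec X w r r<t in s≤s <l , X≡ , rank≡

select-rank : ∀ X w p → p < length w → stepAt w p ≡ X → select X w (rank X w p) ≡ p
select-rank X (s ∷ w) zero    _         refl = select-≡-zero s s w (sameStep-refl s)
select-rank X (s ∷ w) (suc p) (s≤s p<l) X≡   with sameStep X s in eq
... | true  = trans (select-≡-suc X s w (rank X w p) eq) (cong suc (select-rank X w p p<l X≡))
... | false = trans (select-≢ X s w (rank X w p) eq) (cong suc (select-rank X w p p<l X≡))

rank-zero : ∀ X w → rank X w 0 ≡ 0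
rank-zero X []      = refl
rank-zero X (s ∷ w) = refl

rank-mono : ∀ X w {p p′} → p ≤ p′ → rank X w p ≤ rank X w p′
rank-mono X []      _         = z≤n
rank-mono X (s ∷ w) z≤n       = z≤n
rank-mono X (s ∷ w) (s≤s p≤p′) = +-monoʳ-≤ (indicator X s) (rank-mono X w p≤p′)

rank-suc-≡ : ∀ X w p → p < length w → stepAt w p ≡ X → rank X w (suc p) ≡ suc (rank X w p)
rank-suc-≡ X (s ∷ w) zero    _         refl rewrite rank-zero s w | sameStep-refl s = refl
rank-suc-≡ X (s ∷ w) (suc p) (s≤s p<l) X≡   =
  trans (cong (indicator X s +_) (rank-suc-≡ X w p p<l X≡)) (+-suc (indicator X s) (rank X w p))

rank-suc-≢ : ∀ X w p → p < length w → sameStep X (stepAt w p) ≡ false → rank X w (suc p) ≡ rank X w p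
rank-suc-≢ X (s ∷ w) zero    _         ≢X rewrite rank-zero X w | ≢X = refl
rank-suc-≢ X (s ∷ w) (suc p) (s≤s p<l) ≢X = cong (indicator X s +_) (rank-suc-≢ X w p p<l ≢X)

rank≤total : ∀ X w p → rank X w p ≤ total X w
rank≤total X []      p       = z≤n
rank≤total X (s ∷ w) zero    = z≤n
rank≤total X (s ∷ w) (suc p) = +-monoʳ-≤ (indicator X s) (rank≤total X w p)

select-mono : ∀ X w {r r′} → r < r′ → r′ < total X w → select X w r < select X w r′
select-mono X w {r} {r′} r<r′ r′<t = ≰⇒> λ s′≤s → <⇒≱ r<r′ (begin
  r′                         ≡⟨ sym (proj₂ (proj₂ (select-spec X w r′ r′<t))) ⟩
  rank X w (select X w r′)   ≤⟨ rank-mono X w s′≤s ⟩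
  rank X w (select X w r)    ≡⟨ proj₂ (proj₂ (select-spec X w r (<-trans r<r′ r′<t))) ⟩
  r                          ∎)
  where open ≤-Reasoning

IsPath⇒balanced : ∀ h w → IsPath h w → h + total U w ≡ total D w
IsPath⇒balanced h       []      refl          = refl
IsPath⇒balanced h       (U ∷ w) path          = trans (+-suc h (total U w)) (IsPath⇒balanced (suc h) w path)
IsPath⇒balanced (suc h) (D ∷ w) path          = cong suc (IsPath⇒balanced h w path)
IsPath⇒balanced .zero   (F ∷ w) (refl , path) = IsPath⇒balanced 0 w path

IsPath⇒rank-D≤ : ∀ h w p → IsPath h w → rank D w p ≤ h + rank U w p
IsPath⇒rank-D≤ h       []      p       _             = z≤n
IsPath⇒rank-D≤ h       (s ∷ w) zero    _             = z≤n
IsPath⇒rank-D≤ h       (U ∷ w) (suc p) path          =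
  subst (rank D w p ≤_) (sym (+-suc h (rank U w p))) (IsPath⇒rank-D≤ (suc h) w p path)
IsPath⇒rank-D≤ (suc h) (D ∷ w) (suc p) path          = s≤s (IsPath⇒rank-D≤ h w p path)
IsPath⇒rank-D≤ .zero   (F ∷ w) (suc p) (refl , path) = IsPath⇒rank-D≤ 0 w p path

IsPath⇒rank-D< : ∀ h w p → IsPath h w → p < length w → stepAt w p ≡ D → rank D w p < h + rank U w p
IsPath⇒rank-D< (suc h) (D ∷ w) zero    _             _         _  = s≤s z≤n
IsPath⇒rank-D< h       (U ∷ w) (suc p) path          (s≤s p<l) D≡ =
  subst (rank D w p <_) (sym (+-suc h (rank U w p))) (IsPath⇒rank-D< (suc h) w p path p<l D≡)
IsPath⇒rank-D< (suc h) (D ∷ w) (suc p) path          (s≤s p<l) D≡ = s≤s (IsPath⇒rank-D< h w p path p<l D≡)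
IsPath⇒rank-D< .zero   (F ∷ w) (suc p) (refl , path) (s≤s p<l) D≡ = IsPath⇒rank-D< 0 w p path p<l D≡

IsPath⇒rank-F : ∀ h w p → IsPath h w → p < length w → stepAt w p ≡ F → h + rank U w p ≡ rank D w p
IsPath⇒rank-F .zero   (F ∷ w) zero    (refl , _)    _         _  = refl
IsPath⇒rank-F h       (U ∷ w) (suc p) path          (s≤s p<l) F≡ =
  trans (+-suc h (rank U w p)) (IsPath⇒rank-F (suc h) w p path p<l F≡)
IsPath⇒rank-F (suc h) (D ∷ w) (suc p) path          (s≤s p<l) F≡ = cong suc (IsPath⇒rank-F h w p path p<l F≡)
IsPath⇒rank-F .zero   (F ∷ w) (suc p) (refl , path) (s≤s p<l) F≡ = IsPath⇒rank-F 0 w p path p<l F≡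

-- The involution of a path: the r-th up step is matched with the r-th down step, and flat
-- steps are fixed points.
partnerOf : Step → List Step → ℕ → ℕ
partnerOf U w p = select D w (rank U w p)
partnerOf D w p = select U w (rank D w p)
partnerOf F w p = p

partner : List Step → ℕ → ℕ
partner w p = partnerOf (stepAt w p) w p

stepAt-ext : ∀ (A B : List Step) → length A ≡ length B → (∀ p → p < length A → stepAt A p ≡ stepAt B p) → A ≡ B
stepAt-ext []      []      _   _  = refl
stepAt-ext (a ∷ A) (b ∷ B) len at≡ = cong₂ _∷_ (at≡ 0 z<s) (stepAt-ext A B (suc-injective len) (λ p p<l → at≡ (suc p) (s≤s p<l)))

nth-applyUpTo : ∀ f m p → p < m → nth (applyUpTo f m) p ≡ f p
nth-applyUpTo f (suc m) zero    _         = refl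
nth-applyUpTo f (suc m) (suc p) (s≤s p<m) = nth-applyUpTo (f ∘ suc) m p p<m

pathToInvolution : List Step → List ℕ
pathToInvolution w = applyUpTo (partner w) (length w)

module _ (w : List Step) (isPath : IsPath 0 w) where
  private
    n : ℕ
    n = length w

  partner-U : ∀ {p} → stepAt w p ≡ U → partner w p ≡ select D w (rank U w p)
  partner-U U≡ rewrite U≡ = refl

  partner-D : ∀ {p} → stepAt w p ≡ D → partner w p ≡ select U w (rank D w p)
  partner-D D≡ rewrite D≡ = refl

  partner-F : ∀ {p} → stepAt w p ≡ F → partner w p ≡ p
  partner-F F≡ rewrite F≡ = refl

  rank<total : ∀ X p → p < n → stepAt w p ≡ X → rank X w p < total X w
  rank<total X p p<n X≡ = ≤-trans (≤-reflexive (sym (rank-suc-≡ X w p p<n X≡))) (rank≤total X w (suc p))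

  rank-< : ∀ X {p q} → p < q → q ≤ n → stepAt w p ≡ X → rank X w p < rank X w q
  rank-< X {p} p<q q≤n X≡ = ≤-trans (≤-reflexive (sym (rank-suc-≡ X w p (<-≤-trans p<q q≤n) X≡))) (rank-mono X w p<q)

  match-U : ∀ p → p < n → stepAt w p ≡ U →
    partner w p < n × stepAt w (partner w p) ≡ D × rank D w (partner w p) ≡ rank U w p
  match-U p p<n U≡ rewrite partner-U U≡ =
    select-spec D w (rank U w p) (subst (rank U w p <_) (IsPath⇒balanced 0 w isPath) (rank<total U p p<n U≡))

  match-D : ∀ p → p < n → stepAt w p ≡ D →
    partner w p < n × stepAt w (partner w p) ≡ U × rank U w (partner w p) ≡ rank D w p
  match-D p p<n D≡ rewrite partner-D D≡ =
    select-spec U w (rank D w p) (<-≤-trans (IsPath⇒rank-D< 0 w p isPath p<n D≡) (rank≤total U w p))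

  partner-U-> : ∀ p → p < n → stepAt w p ≡ U → p < partner w p
  partner-U-> p p<n U≡ = ≰⇒> λ d≤p → 1+n≰n (begin
    suc (rank U w p)            ≡⟨ cong suc (sym rank≡) ⟩
    suc (rank D w d)            ≡⟨ sym (rank-suc-≡ D w d d<n D≡) ⟩
    rank D w (suc d)            ≤⟨ rank-mono D w (s≤s d≤p) ⟩
    rank D w (suc p)            ≡⟨ rank-suc-≢ D w p p<n (cong (sameStep D) U≡) ⟩
    rank D w p                  ≤⟨ IsPath⇒rank-D≤ 0 w p isPath ⟩
    rank U w p                  ∎)
    where
    open ≤-Reasoning
    d : ℕ
    d = partner w p
    d<n : d < n
    d<n = proj₁ (match-U p p<n U≡)
    D≡ : stepAt w d ≡ D
    D≡ = proj₁ (proj₂ (match-U p p<n U≡))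
    rank≡ : rank D w d ≡ rank U w p
    rank≡ = proj₂ (proj₂ (match-U p p<n U≡))

  partner-D-< : ∀ p → p < n → stepAt w p ≡ D → partner w p < p
  partner-D-< p p<n D≡ = ≰⇒> λ p≤u → <⇒≱ (IsPath⇒rank-D< 0 w p isPath p<n D≡)
    (≤-trans (rank-mono U w p≤u) (≤-reflexive (proj₂ (proj₂ (match-D p p<n D≡)))))

  partner-mono-U : ∀ {i j} → i < j → j < n → stepAt w i ≡ U → stepAt w j ≡ U → partner w i < partner w j
  partner-mono-U {j = j} i<j j<n Ui Uj rewrite partner-U Ui | partner-U Uj =
    select-mono D w (rank-< U i<j (<⇒≤ j<n) Ui) (subst (rank U w j <_) (IsPath⇒balanced 0 w isPath) (rank<total U j j<n Uj))

  partner-mono-D : ∀ {i j} → i < j → j < n → stepAt w i ≡ D → stepAt w j ≡ D → partner w i < partner w j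
  partner-mono-D {j = j} i<j j<n Di Dj rewrite partner-D Di | partner-D Dj =
    select-mono U w (rank-< D i<j (<⇒≤ j<n) Di) (<-≤-trans (IsPath⇒rank-D< 0 w j isPath j<n Dj) (rank≤total U w j))

  -- A flat step lies at height 0, so no arc passes over it.
  partner-U-<-F : ∀ {u f} → u < f → f < n → stepAt w u ≡ U → stepAt w f ≡ F → partner w u < f
  partner-U-<-F {u} {f} u<f f<n U≡ F≡ = ≰⇒> λ f≤d → <⇒≱ (begin-strict
    rank U w u               <⟨ rank-< U u<f (<⇒≤ f<n) U≡ ⟩
    rank U w f               ≡⟨ IsPath⇒rank-F 0 w f isPath f<n F≡ ⟩
    rank D w f               ∎) (begin
    rank D w f               ≤⟨ rank-mono D w f≤d ⟩
    rank D w (partner w u)   ≡⟨ proj₂ (proj₂ (match-U u (<-trans u<f f<n) U≡)) ⟩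
    rank U w u               ∎)
    where open ≤-Reasoning

  viewStep : ∀ p → Σ Step (stepAt w p ≡_)
  viewStep p = stepAt w p , refl

  -- Matching up and down steps in order produces non-nesting arcs, which is what rules out 321.
  partner-avoids321 : ∀ i j k → i < j → j < k → k < n → partner w k < partner w j → partner w j < partner w i → ⊥
  partner-avoids321 i j k i<j j<k k<n πk<πj πj<πi with viewStep i | viewStep j | viewStep k
  ... | U , Ui | U , Uj | _ = <-asym πj<πi (partner-mono-U i<j (<-trans j<k k<n) Ui Uj)
  ... | D , Di | D , Dj | _ = <-asym πj<πi (partner-mono-D i<j (<-trans j<k k<n) Di Dj)
  ... | U , Ui | F , Fj | _ = <-asym πj<πi (subst (partner w i <_) (sym (partner-F Fj))
                                (partner-U-<-F i<j (<-trans j<k k<n) Ui Fj))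
  ... | D , Di | F , Fj | _ = <-asym πj<πi (<-trans (partner-D-< i (<-trans i<j (<-trans j<k k<n)) Di)
                                (subst (i <_) (sym (partner-F Fj)) i<j))
  ... | F , Fi | F , Fj | _ = <-asym πj<πi (subst₂ _<_ (sym (partner-F Fi)) (sym (partner-F Fj)) i<j)
  ... | D , Di | U , Uj | _ = <-asym πj<πi (<-trans (partner-D-< i (<-trans i<j (<-trans j<k k<n)) Di)
                                (<-trans i<j (partner-U-> j (<-trans j<k k<n) Uj)))
  ... | F , Fi | U , Uj | _ = <-asym πj<πi (subst (_< partner w j) (sym (partner-F Fi))
                                (<-trans i<j (partner-U-> j (<-trans j<k k<n) Uj)))
  ... | _ , _  | D , Dj | U , Uk = <-asym πk<πj (<-trans (partner-D-< j (<-trans j<k k<n) Dj)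
                                     (<-trans j<k (partner-U-> k k<n Uk)))
  ... | _ , _  | D , Dj | D , Dk = <-asym πk<πj (partner-mono-D j<k k<n Dj Dk)
  ... | _ , _  | D , Dj | F , Fk = <-asym πk<πj (<-trans (partner-D-< j (<-trans j<k k<n) Dj)
                                     (subst (j <_) (sym (partner-F Fk)) j<k))

  partner<n : ∀ p → p < n → partner w p < n
  partner<n p p<n with viewStep p
  ... | U , U≡ = proj₁ (match-U p p<n U≡)
  ... | D , D≡ = proj₁ (match-D p p<n D≡)
  ... | F , F≡ = subst (_< n) (sym (partner-F F≡)) p<n

  partner-involutive : ∀ p → p < n → partner w (partner w p) ≡ p
  partner-involutive p p<n with viewStep p
  ... | U , U≡ = let (_ , D≡ , rank≡) = match-U p p<n U≡ in
                 trans (partner-D D≡) (trans (cong (select U w) rank≡) (select-rank U w p p<n U≡))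
  ... | D , D≡ = let (_ , U≡ , rank≡) = match-D p p<n D≡ in
                 trans (partner-U U≡) (trans (cong (select D w) rank≡) (select-rank D w p p<n D≡))
  ... | F , F≡ = trans (cong (partner w) (partner-F F≡)) (partner-F F≡)

  stepType-partner : ∀ p → p < n → stepType (partner w p) p ≡ stepAt w p
  stepType-partner p p<n with viewStep p
  ... | U , U≡ = trans (stepType-> (partner-U-> p p<n U≡)) (sym U≡)
  ... | D , D≡ = trans (stepType-< (partner-D-< p p<n D≡)) (sym D≡)
  ... | F , F≡ = trans (stepType-≡ (partner-F F≡)) (sym F≡)

  private
    nth-π : ∀ p → p < n → nth (pathToInvolution w) p ≡ partner w p
    nth-π = nth-applyUpTo (partner w) n

  pathToInvolution-Involution321 : Involution321 n (pathToInvolution w)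
  pathToInvolution-Involution321 = record
    { length≡    = length-applyUpTo (partner w) n
    ; bounded    = λ i i<n → subst (_< n) (sym (nth-π i i<n)) (partner<n i i<n)
    ; involutive = λ i i<n → trans (cong (nth (pathToInvolution w)) (nth-π i i<n))
                                   (trans (nth-π _ (partner<n i i<n)) (partner-involutive i i<n))
    ; avoids321  = λ i j k i<j j<k k<n πk<πj πj<πi → partner-avoids321 i j k i<j j<k k<n
                     (subst₂ _<_ (nth-π k k<n) (nth-π j (<-trans j<k k<n)) πk<πj)
                     (subst₂ _<_ (nth-π j (<-trans j<k k<n)) (nth-π i (<-trans i<j (<-trans j<k k<n))) πj<πi)
    }

  stepTypes-pathToInvolution : stepTypes 0 (pathToInvolution w) ≡ w
  stepTypes-pathToInvolution = stepAt-ext _ w len≡ λ p p<l →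
    trans (stepAt-stepTypes 0 (pathToInvolution w) p (subst (p <_) (length-stepTypes 0 (pathToInvolution w)) p<l))
          (trans (cong (λ x → stepType x p) (nth-π p (subst (p <_) len≡ p<l))) (stepType-partner p (subst (p <_) len≡ p<l)))
    where
    len≡ : length (stepTypes 0 (pathToInvolution w)) ≡ n
    len≡ = trans (length-stepTypes 0 (pathToInvolution w)) (length-applyUpTo (partner w) n)

Unique-allFinList : ∀ n → Unique (allFinList n)
Unique-allFinList zero    = []
Unique-allFinList (suc n) =
  All.tabulate (λ i∈ 0≡i → case (∈-map⁻ Fin.suc i∈) 0≡i) ∷ Uniqueₚ.map⁺ Finₚ.suc-injective (Unique-allFinList n)
  where
  case : ∀ {i} → Σ (Fin n) (λ j → j ∈ allFinList n × i ≡ Fin.suc j) → Fin.zero ≢ i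
  case (_ , _ , refl) ()

allFinList-complete : ∀ {n} (i : Fin n) → i ∈ allFinList n
allFinList-complete Fin.zero    = here refl
allFinList-complete (Fin.suc i) = there (∈-map⁺ Fin.suc (allFinList-complete i))

Unique-allWords : {A : Set} (xs : List A) (m : ℕ) → Unique xs → Unique (allWords xs m)
Unique-allWords xs zero    _   = All.[] ∷ []
Unique-allWords xs (suc m) uxs = Uniqueₚ.concat⁺
  (All.tabulate λ {ws} ws∈ → case (∈-map⁻ _ ws∈))
  (AllPairsₚ.map⁺ (AllPairs.map (λ x≢y {v} → map-disjoint (x≢y ∘ Vecₚ.∷-injectiveˡ) (allWords xs m) (allWords xs m) {v}) uxs))
  where
  case : ∀ {ws} → Σ _ (λ x → x ∈ xs × ws ≡ map (x Vec.∷_) (allWords xs m)) → Unique ws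
  case (x , _ , refl) = Uniqueₚ.map⁺ Vecₚ.∷-injectiveʳ (Unique-allWords xs m uxs)

allWords-complete : {A : Set} (xs : List A) {m : ℕ} (v : Vec A m) → (∀ i → lookup v i ∈ xs) → v ∈ allWords xs m
allWords-complete xs Vec.[]       _      = here refl
allWords-complete xs (x Vec.∷ v) x∈,v∈ =
  ∈-concatMap⁺ (λ y → map (y Vec.∷_) (allWords xs _)) (Any.map (λ { refl → ∈-map⁺ (x Vec.∷_) (allWords-complete xs v (x∈,v∈ ∘ Fin.suc)) }) (x∈,v∈ Fin.zero))

Unique-I321 : ∀ n → Unique (I321 n)
Unique-I321 n = Uniqueₚ.filter⁺ _ (Unique-allWords (allFinList n) n (Unique-allFinList n))

toℕs : ∀ {n m} → Vec (Fin n) m → List ℕ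
toℕs σ = map toℕ (toList σ)

nth-toℕs : ∀ {n m} (σ : Vec (Fin n) m) (i : Fin m) → nth (toℕs σ) (toℕ i) ≡ toℕ (lookup σ i)
nth-toℕs (x Vec.∷ σ) Fin.zero    = refl
nth-toℕs (x Vec.∷ σ) (Fin.suc i) = nth-toℕs σ i

length-toℕs : ∀ {n m} (σ : Vec (Fin n) m) → length (toℕs σ) ≡ m
length-toℕs Vec.[]      = refl
length-toℕs (x Vec.∷ σ) = cong suc (length-toℕs σ)

toℕs-injective : ∀ {n m} (σ τ : Vec (Fin n) m) → toℕs σ ≡ toℕs τ → σ ≡ τ
toℕs-injective Vec.[]      Vec.[]      _   = refl
toℕs-injective (x Vec.∷ σ) (y Vec.∷ τ) eq =
  cong₂ Vec._∷_ (toℕ-injective (Listₚ.∷-injectiveˡ eq)) (toℕs-injective σ τ (Listₚ.∷-injectiveʳ eq))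

module _ {n : ℕ} where
  nth-word : (σ : Vec (Fin n) n) → ∀ i → (i<n : i < n) → nth (word σ) i ≡ toℕ (lookup σ (fromℕ< i<n))
  nth-word σ i i<n = trans (cong (nth (word σ)) (sym (toℕ-fromℕ< i<n))) (nth-toℕs σ (fromℕ< i<n))

  I321⇒Involution321 : ∀ {σ} → σ ∈ I321 n → Involution321 n (word σ)
  I321⇒Involution321 {σ} σ∈ = record
    { length≡    = length-toℕs σ
    ; bounded    = λ i i<n → subst (_< n) (sym (nth-word σ i i<n)) (toℕ<n _)
    ; involutive = λ i i<n → trans (cong (nth (word σ)) (nth-word σ i i<n))
                     (trans (nth-toℕs σ (lookup σ (fromℕ< i<n))) (trans (cong toℕ (inv (fromℕ< i<n))) (toℕ-fromℕ< i<n)))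
    ; avoids321  = λ i j k i<j j<k k<n σk<σj σj<σi →
        let i<n = <-trans i<j (<-trans j<k k<n) ; j<n = <-trans j<k k<n in
        avoids (fromℕ< i<n) (fromℕ< j<n) (fromℕ< k<n)
          (subst₂ _<_ (sym (toℕ-fromℕ< i<n)) (sym (toℕ-fromℕ< j<n)) i<j)
          (subst₂ _<_ (sym (toℕ-fromℕ< j<n)) (sym (toℕ-fromℕ< k<n)) j<k)
          (subst₂ _<_ (nth-word σ k k<n) (nth-word σ j j<n) σk<σj , subst₂ _<_ (nth-word σ j j<n) (nth-word σ i i<n) σj<σi)
    }
    where
    inv : IsInvolution σ
    inv = proj₁ (proj₂ (∈-filter⁻ (λ σ → IsInvolution? σ ×-dec Avoids321? σ) {xs = allMaps n} σ∈))
    avoids : Avoids321 σ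
    avoids = proj₂ (proj₂ (∈-filter⁻ (λ σ → IsInvolution? σ ×-dec Avoids321? σ) {xs = allMaps n} σ∈))

  fromInvolution321 : ∀ {L} → Involution321 n L → Vec (Fin n) n
  fromInvolution321 σ = tabulate (λ i → fromℕ< (Involution321.bounded σ (toℕ i) (toℕ<n i)))

  module _ {L} (σ : Involution321 n L) where
    private
      toℕ-lookup : ∀ i → toℕ (lookup (fromInvolution321 σ) i) ≡ nth L (toℕ i)
      toℕ-lookup i = trans (cong toℕ (lookup∘tabulate _ i)) (toℕ-fromℕ< _)

    word-fromInvolution321 : word (fromInvolution321 σ) ≡ L
    word-fromInvolution321 = nth-ext _ L (trans (length-toℕs (fromInvolution321 σ)) (sym (Involution321.length≡ σ)))
      λ p p<l → let p<n = subst (p <_) (length-toℕs (fromInvolution321 σ)) p<l in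
        trans (nth-word (fromInvolution321 σ) p p<n) (trans (toℕ-lookup (fromℕ< p<n)) (cong (nth L) (toℕ-fromℕ< p<n)))

    fromInvolution321∈I321 : fromInvolution321 σ ∈ I321 n
    fromInvolution321∈I321 = ∈-filter⁺ (λ τ → IsInvolution? τ ×-dec Avoids321? τ)
      (allWords-complete (allFinList n) (fromInvolution321 σ) (λ i → allFinList-complete _))
      ( (λ i → toℕ-injective (trans (toℕ-lookup _) (trans (cong (nth L) (toℕ-lookup i))
                                                      (Involution321.involutive σ (toℕ i) (toℕ<n i)))))
      , (λ i j k i<j j<k (σk<σj , σj<σi) → Involution321.avoids321 σ (toℕ i) (toℕ j) (toℕ k) i<j j<k (toℕ<n k)
                                             (subst₂ _<_ (toℕ-lookup k) (toℕ-lookup j) σk<σj)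
                                             (subst₂ _<_ (toℕ-lookup j) (toℕ-lookup i) σj<σi)))

module _ (n : ℕ) where
  ∈paths⇒Involution321 : ∀ {w} → w ∈ paths 0 n → Involution321 n (pathToInvolution w)
  ∈paths⇒Involution321 {w} w∈ = let (isPath , length≡) = ∈paths⇒IsPath 0 n w∈ in
    subst (λ m → Involution321 m (pathToInvolution w)) length≡ (pathToInvolution-Involution321 w isPath)

  -- The bijection: σ ↦ stepTypes 0 (word σ), with inverse pathToInvolution.
  sumOf-I321≡sumOf-paths : (Φ : List ℕ → ℕ) → sumOf (Φ ∘ word) (I321 n) ≡ sumOf (Φ ∘ pathToInvolution) (paths 0 n)
  sumOf-I321≡sumOf-paths Φ = begin
    sumOf (Φ ∘ word) (I321 n)                     ≡⟨ sumOf-map Φ word (I321 n) ⟨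
    sumOf Φ (map word (I321 n))                   ≡⟨ sumOf-∼set Φ unique-words unique-paths to from ⟩
    sumOf Φ (map pathToInvolution (paths 0 n))    ≡⟨ sumOf-map Φ pathToInvolution (paths 0 n) ⟩
    sumOf (Φ ∘ pathToInvolution) (paths 0 n)      ∎
    where
    open ≡-Reasoning
    stepTypes∘pathToInvolution : ∀ {w} → w ∈ paths 0 n → stepTypes 0 (pathToInvolution w) ≡ w
    stepTypes∘pathToInvolution w∈ = stepTypes-pathToInvolution _ (proj₁ (∈paths⇒IsPath 0 n w∈))
    unique-words : Unique (map word (I321 n))
    unique-words = Uniqueₚ.map⁺ (toℕs-injective _ _) (Unique-I321 n)
    unique-paths : Unique (map pathToInvolution (paths 0 n))
    unique-paths = Unique-map⁺-on pathToInvolution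
      (λ v∈ w∈ π≡ → trans (sym (stepTypes∘pathToInvolution v∈)) (trans (cong (stepTypes 0) π≡) (stepTypes∘pathToInvolution w∈)))
      (Unique-paths 0 n)
    to : ∀ {L} → L ∈ map word (I321 n) → L ∈ map pathToInvolution (paths 0 n)
    to L∈ with ∈-map⁻ word L∈
    ... | σ , σ∈ , refl = subst (_∈ map pathToInvolution (paths 0 n))
                                (stepTypes-injective (∈paths⇒Involution321 w∈) (I321⇒Involution321 σ∈) (stepTypes∘pathToInvolution w∈))
                                (∈-map⁺ pathToInvolution w∈)
      where
      w∈ : stepTypes 0 (word σ) ∈ paths 0 n
      w∈ = stepTypes∈paths (I321⇒Involution321 σ∈)
    from : ∀ {L} → L ∈ map pathToInvolution (paths 0 n) → L ∈ map word (I321 n)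
    from L∈ with ∈-map⁻ pathToInvolution L∈
    ... | w , w∈ , refl = subst (_∈ map word (I321 n)) (word-fromInvolution321 (∈paths⇒Involution321 w∈))
                                (∈-map⁺ word (fromInvolution321∈I321 (∈paths⇒Involution321 w∈)))

descents-pathToInvolution : ∀ w → IsPath 0 w → descents 1 (pathToInvolution w) ≡ peaks 1 w
descents-pathToInvolution w isPath = trans (Involution321⇒descents≡peaks (pathToInvolution-Involution321 w isPath))
                                           (cong (peaks 1) (stepTypes-pathToInvolution w isPath))

head+1 : List ℕ → ℕ
head+1 []      = 0
head+1 (x ∷ _) = suc x

lead≡head+1 : ∀ {n} (σ : Vec (Fin n) n) → lead σ ≡ head+1 (word σ)
lead≡head+1 σ with word σ
... | []    = refl
... | _ ∷ _ = refl

head+1-pathToInvolution : ∀ w → IsPath 0 w → 1 ≤ length w → head+1 (pathToInvolution w) ≡ suc (initialUps w)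
head+1-pathToInvolution w@(_ ∷ _) isPath _ = cong suc
  (trans (head≡initialUps _ _ (pathToInvolution-Involution321 w isPath)) (cong initialUps (stepTypes-pathToInvolution w isPath)))

majGF-des-closed : ∀ n k q → majGF-des q n k ≡ q ^ (k * k) * qbinom q ⌈ n /2⌉ k * qbinom q ⌊ n /2⌋ k
majGF-des-closed n k q = begin
  majGF-des q n k                               ≡⟨ sum-map-filter (λ σ → des σ ≟ k) (λ σ → q ^ maj σ) (I321 n) ⟩
  sumOf (Φ ∘ word) (I321 n)                     ≡⟨ sumOf-I321≡sumOf-paths n Φ ⟩
  sumOf (Φ ∘ pathToInvolution) (paths 0 n)      ≡⟨ sumOf-cong∈ (paths 0 n) descents≡ ⟩
  pathGF q n 0 k                                ≡⟨ pathGF-closed q n k ⟩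
  qbinProd q ⌈ n /2⌉ ⌊ n /2⌋ k                 ≡⟨ cong₂ (λ a b → q ^ (k * k) * a * b) (qbinom≡qbin q ⌈ n /2⌉ k)
                                                          (qbinom≡qbin q ⌊ n /2⌋ k) ⟨
  q ^ (k * k) * qbinom q ⌈ n /2⌉ k * qbinom q ⌊ n /2⌋ k ∎
  where
  open ≡-Reasoning
  Φ : List ℕ → ℕ
  Φ L = if length (descents 1 L) ≡ᵇ k then q ^ sum (descents 1 L) else 0
  descents≡ : ∀ w → w ∈ paths 0 n → Φ (pathToInvolution w) ≡ peakWeight q k 1 w
  descents≡ w w∈ = cong (λ ds → if length ds ≡ᵇ k then q ^ sum ds else 0)
                        (descents-pathToInvolution w (proj₁ (∈paths⇒IsPath 0 n w∈)))

majGF-lead-closed : ∀ n → 1 ≤ n → ∀ u → suc u ≤ ⌊ n /2⌋ + 1 → (q : ℕ) → majGF-lead q n (suc u) ≡ leadRHS q n (suc u)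
majGF-lead-closed n 1≤n u ℓ≤ q = begin
  majGF-lead q n (suc u)                        ≡⟨ sum-map-filter (λ σ → lead σ ≟ suc u) (λ σ → q ^ maj σ) (I321 n) ⟩
  sumOf (λ σ → if lead σ ≡ᵇ suc u then q ^ maj σ else 0) (I321 n)
                                                ≡⟨ sumOf-cong (λ σ → cong (λ l → if l ≡ᵇ suc u then q ^ maj σ else 0) (lead≡head+1 σ)) (I321 n) ⟩
  sumOf (Φ ∘ word) (I321 n)                     ≡⟨ sumOf-I321≡sumOf-paths n Φ ⟩
  sumOf (Φ ∘ pathToInvolution) (paths 0 n)      ≡⟨ sumOf-cong∈ (paths 0 n) on-paths ⟩
  pathLeadGF q n u                              ≡⟨ pathLeadGF-closed q n u 1≤n ℓ≤ ⟩
  leadRHS q n (suc u)                           ∎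
  where
  open ≡-Reasoning
  Φ : List ℕ → ℕ
  Φ L = if head+1 L ≡ᵇ suc u then q ^ sum (descents 1 L) else 0
  on-paths : ∀ w → w ∈ paths 0 n → Φ (pathToInvolution w) ≡ restrictUps q u 1 w
  on-paths w w∈ = let (isPath , length≡) = ∈paths⇒IsPath 0 n w∈ in
    cong₂ (λ l ds → if l ≡ᵇ suc u then q ^ sum ds else 0)
          (head+1-pathToInvolution w isPath (subst (1 ≤_) (sym length≡) 1≤n)) (descents-pathToInvolution w isPath)

theorem1p4 : (n : ℕ) → 1 ≤ n →
    ((k q : ℕ) →
      majGF-des q n k ≡ q ^ (k * k) * qbinom q ⌈ n /2⌉ k * qbinom q ⌊ n /2⌋ k)
    × ((ℓ : ℕ) → 1 ≤ ℓ → ℓ ≤ ⌊ n /2⌋ + 1 → (q : ℕ) →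
      majGF-lead q n ℓ ≡ leadRHS q n ℓ)
theorem1p4 n 1≤n = (λ k q → majGF-des-closed n k q) , by-lead
  where
  by-lead : (ℓ : ℕ) → 1 ≤ ℓ → ℓ ≤ ⌊ n /2⌋ + 1 → (q : ℕ) → majGF-lead q n ℓ ≡ leadRHS q n ℓ
  by-lead (suc u) _ = majGF-lead-closed n 1≤n u
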